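{- Let $q$ be an odd prime power and let $P(q^2)$ be the Paley graph of order $q^2$. For every quadratic line $S$ of $\mathbb{F}_{q^2}$, let $g_S:\mathbb{F}_{q^2}\to\mathbb{R}$ be given by $g_S(\gamma)=q-1$ if $\gamma\in S$ and $g_S(\gamma)=-1$ otherwise. Then the functions $g_S$, where $S$ runs over all $\frac{q(q+1)}{2}$ quadratic lines, span the eigenspace of $P(q^2)$ corresponding to the eigenvalue $\frac{ -1+q}{2}$.
   Context: The Paley graph $P(q^2)$ has vertex set $\mathbb{F}_{q^2}$, two distinct elements $\gamma_1,\gamma_2$ being adjacent iff $\gamma_1-\gamma_2$ is a square in $\mathbb{F}_{q^2}^*$. View $\mathbb{F}_{q^2}$ as a $2$-dimensional vector space over $\mathbb{F}_q$ (the affine plane $A(2,q)$). A line is a set $\{a+cb : c\in\mathbb{F}_q\}$ with $a\in\mathbb{F}_{q^2}$, $b\in\mathbb{F}_{q^2}^*$; $b$ is its slope (defined up to multiplication by elements of $\mathbb{F}_q^*$, all of which are squares in $\mathbb{F}_{q^2}^*$). A line is quadratic if its slope is a square in $\mathbb{F}_{q^2}^*$. There are $\frac{q+1}{2}$ quadratic slopes (parallel classes), each consisting of $q$ parallel lines partitioning $\mathbb{F}_{q^2}$; quadratic lines are cliques of size $q$ in $P(q^2)$ (the canonical cliques), and $g_S$ equals $q$ times the balanced characteristic vector $v_S-\frac{1}{q}\mathbf{1}$ of $S$. A $\theta$-eigenfunction is a real function $f$ on the vertices with $\theta f(\gamma)=\sum_{\delta\sim\gamma}f(\delta)$ for all vertices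 $\gamma$; the $\theta$-eigenspace consists of these functions together with $0$.
   Formalization: The eigenfunctions and the coefficients of linear combinations of the functions $g_S$ take values in ℚ instead of ℝ. -}

module Defs where

open import Data.Nat as ℕ using (ℕ; zero; suc)
open import Data.Nat.Primality using (Prime)
open import Data.Integer using (+_)
open import Data.Product using (Σ; ∃; _×_; _,_)
open import Data.List using (List; filter; map; foldr; length)
open import Data.List.Membership.Propositional using (_∈_; lose)
open import Data.List.Relation.Unary.Any using (any?; satisfied)
open import Data.List.Relation.Unary.All using (All)
open import Data.List.Relation.Unary.Unique.Propositional using (Unique)
open import Data.Rational as ℚ using (ℚ)
open import Relation.Nullary using (¬_; Dec; yes; no)
open import Relation.Nullary.Decidable using (_×-dec_; ¬?)
open import Relation.Binary.PropositionalEquality using (_≡_)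
open import Relation.Binary.Definitions using (DecidableEquality)
open import Algebra.Structures using (IsCommutativeRing)

IsOddPrimePower : ℕ → Set
IsOddPrimePower q = Σ ℕ λ p → Σ ℕ λ k → Prime p × q ≡ p ℕ.^ suc k × q ℕ.% 2 ≡ 1

record FiniteField : Set₁ where
  infixl 6 _+_
  infixl 7 _*_
  field
    Carrier : Set
    _+_ _*_ : Carrier → Carrier → Carrier
    -_ : Carrier → Carrier
    0# 1# : Carrier
    isCommutativeRing : IsCommutativeRing _≡_ _+_ _*_ -_ 0# 1#
    0≢1 : ¬ (0# ≡ 1#)
    inverse : ∀ x → ¬ (x ≡ 0#) → ∃ λ y → x * y ≡ 1#
    _≟_ : DecidableEquality Carrier
    elements : List Carrier
    complete : ∀ x → x ∈ elements
    unique : Unique elements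

  order : ℕ
  order = length elements

  _-_ : Carrier → Carrier → Carrier
  x - y = x + (- y)

  _^_ : Carrier → ℕ → Carrier
  x ^ zero = 1#
  x ^ suc n = x * (x ^ n)

sumℚ : List ℚ → ℚ
sumℚ = foldr ℚ._+_ ℚ.0ℚ

ℕtoℚ : ℕ → ℚ
ℕtoℚ n = + n ℚ./ 1

module _ (F : FiniteField) where
  open FiniteField F

  IsNonzeroSquare : Carrier → Set
  IsNonzeroSquare x = ∃ λ y → ¬ (y ≡ 0#) × y * y ≡ x

  isNonzeroSquare? : ∀ x → Dec (IsNonzeroSquare x)
  isNonzeroSquare? x with any? (λ y → ¬? (y ≟ 0#) ×-dec ((y * y) ≟ x)) elements
  ... | yes p = yes (satisfied p)
  ... | no ¬p = no λ { (y , h) → ¬p (lose (complete y) h) }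

  PaleyAdj : Carrier → Carrier → Set
  PaleyAdj γ δ = ¬ (γ ≡ δ) × IsNonzeroSquare (γ - δ)

  paleyAdj? : ∀ γ δ → Dec (PaleyAdj γ δ)
  paleyAdj? γ δ = ¬? (γ ≟ δ) ×-dec isNonzeroSquare? (γ - δ)

  IsEigenfunction : ℚ → (Carrier → ℚ) → Set
  IsEigenfunction θ f =
    ∀ γ → θ ℚ.* f γ ≡ sumℚ (map f (filter (paleyAdj? γ) elements))

  -- The subfield F_q of F = F_{q²}, i.e. {c | c^q = c}, and the line
  -- {a + c b : c ∈ F_q} with point a and slope b.
  module _ (q : ℕ) where
    InSubfield : Carrier → Set
    InSubfield c = c ^ q ≡ c

    OnLine : Carrier → Carrier → Carrier → Set
    OnLine a b γ = ∃ λ c → InSubfield c × γ ≡ a + c * b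

    onLine? : ∀ a b γ → Dec (OnLine a b γ)
    onLine? a b γ with any? (λ c → ((c ^ q) ≟ c) ×-dec (γ ≟ (a + c * b))) elements
    ... | yes p = yes (satisfied p)
    ... | no ¬p = no λ { (c , h) → ¬p (lose (complete c) h) }

    gLine : Carrier → Carrier → Carrier → ℚ
    gLine a b γ with onLine? a b γ
    ... | yes _ = ℕtoℚ q ℚ.- ℚ.1ℚ
    ... | no _ = ℚ.- ℚ.1ℚ

    -- A quadratic line: slope b a nonzero square.
    -- f lies in the (rational) span of the g_S over all quadratic lines S:
    -- f is a finite linear combination Σ r_i g_{S_i}, S_i = line(a_i, b_i).
    InSpanOfQuadraticLines : (Carrier → ℚ) → Set
    InSpanOfQuadraticLines f =
      Σ (List (Carrier × Carrier × ℚ)) λ ls →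
        All (λ { (a , b , r) → IsNonzeroSquare b }) ls ×
        (∀ γ → f γ ≡ sumℚ (map (λ { (a , b , r) → r ℚ.* gLine a b γ }) ls))

{-# OPTIONS --safe #-}

-- Let K = 𝔽_q be the fixed field of x ↦ x ^ q in F = 𝔽_{q²}, t = (q - 1) / 2 (so θ = t) and
-- M = (q² - 1) / 2 the number of nonzero squares. For f : F → ℚ put A f γ = Σ_{s square} f (γ - s)
-- and L_s f γ = Σ_{c ∈ K} f (γ - c s), the sum of f over the line through γ with slope s.
-- As K* consists of squares, every square is c s for exactly q - 1 pairs (c ∈ K*, s square), so
--   Σ_{s square} L_s f γ = M f γ + (q - 1) A f γ.
-- For g_S with S of slope b, L_s g_S = q g_S if s ∈ K* b and L_s g_S = 0 otherwise (the lines of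
-- slope s then meet S exactly once, as F = K s ⊕ K b); the identity gives A g_S = t g_S.
-- Conversely, if A f = t f then Σ f = 0 (as M ≠ t), hence Σ_a f a g_{a,s} = q L_s f, and summing
-- over the squares s expresses q (q - 1) q f as a combination of the g_S.

module Submission where

open import Defs

open import Algebra.Bundles using (CommutativeSemigroup; CommutativeRing)
open import Algebra.Structures using (IsCommutativeMonoid; IsCommutativeRing)
import Algebra.Solver.Ring.NaturalCoefficients.Default
open import Data.List using (List; []; _∷_; _++_; map; filter; concatMap; length; replicate; cartesianProduct)
open import Data.List.Properties using (length-++; length-map; length-replicate; length-++-sucʳ; filter-all)
open import Data.List.Membership.Propositional using (_∈_; lose)
open import Data.List.Membership.Propositional.Properties
  using (∈-∃++; ∈-++⁻; ∈-++⁺ˡ; ∈-++⁺ʳ; ∈-filter⁺; ∈-filter⁻; ∈-length; ∈-map⁻;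
         ∈-cartesianProduct⁺; ∈-cartesianProduct⁻)
open import Data.List.Relation.Binary.Subset.Propositional using (_⊆_)
open import Data.List.Relation.Unary.Any using (here; there; any?; satisfied)
open import Data.List.Relation.Unary.All as All using ([])
open import Data.List.Relation.Unary.All.Properties using () renaming (map⁺ to All-map⁺; concat⁺ to All-concat⁺)
open import Data.List.Relation.Unary.AllPairs using ([]; _∷_)
open import Data.List.Relation.Unary.Unique.Propositional using (Unique)
open import Data.List.Relation.Unary.Unique.Propositional.Properties using ()
  renaming (filter⁺ to Unique-filter⁺; map⁺ to Unique-map⁺; cartesianProduct⁺ to Unique-cartesianProduct⁺)
open import Data.Nat as ℕ using (ℕ; zero; suc)
open import Data.Nat.Combinatorics using (_C_; nCn≡1)
open import Data.Nat.Divisibility using (divides)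
open import Data.Nat.Primality using (Prime; prime⇒nonZero)
open import Data.Fin as Fin using (Fin; toℕ; fromℕ)
open import Data.Fin.Properties using (toℕ-fromℕ)
import Data.Nat.Properties as ℕₚ
open import Data.Nat.DivMod using (m≡m%n+[m/n]*n)
import Data.Nat.Solver
import Data.Integer as ℤ
open import Data.Rational as ℚ using (ℚ; 0ℚ; 1ℚ; ½; ↥_)
import Data.Rational.Properties as ℚₚ
open import Data.Product using (∃; _×_; _,_; proj₁; proj₂; map₂)
open import Function.Bundles using (_⇔_; mk⇔)
open import Data.Sum using (_⊎_; inj₁; inj₂; [_,_]′)
open import Function using (_∘_; id)
open import Relation.Binary.Definitions using (DecidableEquality)
open import Relation.Binary.PropositionalEquality
open import Relation.Nullary using (¬_; Dec; yes; no; contradiction)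
open import Relation.Nullary.Decidable using (_×-dec_; _⊎-dec_; ¬?)

module ListSum {A : Set} {_∙_ : A → A → A} {ε : A}
               (isCommutativeMonoid : IsCommutativeMonoid _≡_ _∙_ ε) where

  open IsCommutativeMonoid isCommutativeMonoid
    using (assoc; identityˡ; identityʳ; isCommutativeSemigroup)

  commutativeSemigroup : CommutativeSemigroup _ _
  commutativeSemigroup = record { isCommutativeSemigroup = isCommutativeSemigroup }

  open import Algebra.Properties.CommutativeSemigroup commutativeSemigroup using (interchange)

  ∑ : {X : Set} → List X → (X → A) → A
  ∑ []       f = ε
  ∑ (x ∷ xs) f = f x ∙ ∑ xs f

  syntax ∑ xs (λ x → e) = ∑[ x ∈ xs ] e

  when : {P : Set} → Dec P → A → A
  when (yes _) a = a
  when (no _)  _ = ε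

  module _ {P Q : Set} where

    when-⇔ : (p : Dec P) (q : Dec Q) → (P → Q) → (Q → P) → ∀ a → when p a ≡ when q a
    when-⇔ (yes _) (yes _) _   _   _ = refl
    when-⇔ (yes p) (no ¬q) p⇒q _   _ = contradiction (p⇒q p) ¬q
    when-⇔ (no ¬p) (yes q) _   q⇒p _ = contradiction (q⇒p q) ¬p
    when-⇔ (no _)  (no _)  _   _   _ = refl

    when-×-dec : (p : Dec P) (q : Dec Q) → ∀ a → when p (when q a) ≡ when (p ×-dec q) a
    when-×-dec (yes _) (yes _) _ = refl
    when-×-dec (yes _) (no _)  _ = refl
    when-×-dec (no _)  _       _ = refl

    when-⊎-dec : (p : Dec P) (q : Dec Q) → ¬ (P × Q) → ∀ a → when (p ⊎-dec q) a ≡ when p a ∙ when q a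
    when-⊎-dec (yes p) (yes q) ¬p×q _ = contradiction (p , q) ¬p×q
    when-⊎-dec (yes _) (no _)  _    a = sym (identityʳ a)
    when-⊎-dec (no _)  (yes _) _    a = sym (identityˡ a)
    when-⊎-dec (no _)  (no _)  _    _ = sym (identityˡ ε)

    when-comm : (p : Dec P) (q : Dec Q) → ∀ a → when p (when q a) ≡ when q (when p a)
    when-comm (yes _) (yes _) _ = refl
    when-comm (yes _) (no _)  _ = refl
    when-comm (no _)  (yes _) _ = refl
    when-comm (no _)  (no _)  _ = refl

    when-split : (p : Dec P) (q : Dec Q) → ∀ a → when p a ≡ when (p ×-dec q) a ∙ when (p ×-dec ¬? q) a
    when-split (yes _) (yes _) a = sym (identityʳ a)
    when-split (yes _) (no _)  a = sym (identityˡ a)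
    when-split (no _)  _       _ = sym (identityˡ ε)

  module _ {P : Set} where

    when-yes : (p : Dec P) → P → ∀ a → when p a ≡ a
    when-yes (yes _) _ _ = refl
    when-yes (no ¬p) p _ = contradiction p ¬p

    when-no : (p : Dec P) → ¬ P → ∀ a → when p a ≡ ε
    when-no (yes p) ¬p _ = contradiction p ¬p
    when-no (no _)  _  _ = refl

    when-∙ : (p : Dec P) → ∀ a b → when p (a ∙ b) ≡ when p a ∙ when p b
    when-∙ (yes _) _ _ = refl
    when-∙ (no _)  _ _ = sym (identityˡ ε)

    when-cong : (p : Dec P) {a b : A} → (P → a ≡ b) → when p a ≡ when p b
    when-cong (yes p) a≡b = a≡b p
    when-cong (no _)  _   = refl

  module _ {X : Set} where

    ∑-cong-∈ : ∀ xs {f g : X → A} → (∀ {x} → x ∈ xs → f x ≡ g x) → ∑ xs f ≡ ∑ xs g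
    ∑-cong-∈ []       _   = refl
    ∑-cong-∈ (x ∷ xs) f≡g = cong₂ _∙_ (f≡g (here refl)) (∑-cong-∈ xs (f≡g ∘ there))

    ∑-cong : ∀ xs {f g : X → A} → (∀ x → f x ≡ g x) → ∑ xs f ≡ ∑ xs g
    ∑-cong xs f≡g = ∑-cong-∈ xs (λ {x} _ → f≡g x)

    ∑-ε : ∀ (xs : List X) → ∑[ x ∈ xs ] ε ≡ ε
    ∑-ε []       = refl
    ∑-ε (_ ∷ xs) = trans (identityˡ _) (∑-ε xs)

    ∑-∙ : ∀ xs (f g : X → A) → ∑[ x ∈ xs ] (f x ∙ g x) ≡ ∑ xs f ∙ ∑ xs g
    ∑-∙ []       _ _ = sym (identityˡ ε)
    ∑-∙ (x ∷ xs) f g = trans (cong (_ ∙_) (∑-∙ xs f g)) (interchange _ _ _ _)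

    ∑-++ : ∀ xs ys (f : X → A) → ∑ (xs ++ ys) f ≡ ∑ xs f ∙ ∑ ys f
    ∑-++ []       _  _ = sym (identityˡ _)
    ∑-++ (x ∷ xs) ys f = trans (cong (_ ∙_) (∑-++ xs ys f)) (sym (assoc _ _ _))

    ∑-filter : {P : X → Set} (P? : ∀ x → Dec (P x)) → ∀ xs (f : X → A) →
               ∑ (filter P? xs) f ≡ ∑[ x ∈ xs ] when (P? x) (f x)
    ∑-filter P? []       _ = refl
    ∑-filter P? (x ∷ xs) f with P? x
    ... | yes _ = cong (f x ∙_) (∑-filter P? xs f)
    ... | no  _ = trans (∑-filter P? xs f) (sym (identityˡ _))

    when-∑ : {P : Set} (p : Dec P) → ∀ xs (f : X → A) → when p (∑ xs f) ≡ ∑[ x ∈ xs ] when p (f x)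
    when-∑ (yes _) _  _ = refl
    when-∑ (no _)  xs _ = sym (∑-ε xs)

    module _ {P : X → Set} (P? : ∀ x → Dec (P x)) (f : X → A) where

      ∑-when-none : ∀ xs → (∀ {x} → x ∈ xs → ¬ P x) → ∑[ x ∈ xs ] when (P? x) (f x) ≡ ε
      ∑-when-none []       _    = refl
      ∑-when-none (x ∷ xs) none =
        trans (cong₂ _∙_ (when-no (P? x) (none (here refl)) _) (∑-when-none xs (λ m → none (there m))))
              (identityˡ ε)

      ∑-when-unique : ∀ {xs z} → Unique xs → z ∈ xs → P z → (∀ x → P x → x ≡ z) →
                      ∑[ x ∈ xs ] when (P? x) (f x) ≡ f z
      ∑-when-unique {x ∷ xs} (x∉xs ∷ _) (here refl) pz unique =
        trans (cong₂ _∙_ (when-yes (P? x) pz _)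
                         (∑-when-none xs (λ m py → All.lookup x∉xs m (sym (unique _ py)))))
              (identityʳ _)
      ∑-when-unique {x ∷ xs} (x∉xs ∷ xs!) (there z∈xs) pz unique =
        trans (cong₂ _∙_ (when-no (P? x) (λ px → All.lookup x∉xs z∈xs (unique x px)) _)
                         (∑-when-unique xs! z∈xs pz unique))
              (identityˡ _)

  module _ {X Y : Set} where

    ∑-map : ∀ (g : X → Y) xs (f : Y → A) → ∑ (map g xs) f ≡ ∑[ x ∈ xs ] f (g x)
    ∑-map g []       _ = refl
    ∑-map g (x ∷ xs) f = cong (_ ∙_) (∑-map g xs f)

    ∑-concatMap : ∀ (g : X → List Y) xs (f : Y → A) → ∑ (concatMap g xs) f ≡ ∑[ x ∈ xs ] ∑ (g x) f
    ∑-concatMap g []       _ = refl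
    ∑-concatMap g (x ∷ xs) f = trans (∑-++ (g x) _ f) (cong (_ ∙_) (∑-concatMap g xs f))

    ∑-swap : ∀ xs ys (f : X → Y → A) → ∑[ x ∈ xs ] ∑[ y ∈ ys ] f x y ≡ ∑[ y ∈ ys ] ∑[ x ∈ xs ] f x y
    ∑-swap []       ys _ = sym (∑-ε ys)
    ∑-swap (x ∷ xs) ys f = trans (cong (_ ∙_) (∑-swap xs ys f)) (sym (∑-∙ ys (f x) _))

  module Enumeration {X : Set} (_≟_ : DecidableEquality X) (xs : List X)
                     (xs! : Unique xs) (complete : ∀ x → x ∈ xs) where

    ∑-when-≡ : ∀ (f : X → A) z → ∑[ x ∈ xs ] when (x ≟ z) (f x) ≡ f z
    ∑-when-≡ f z = ∑-when-unique (_≟ z) f xs! (complete z) refl (λ _ x≡z → x≡z)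

    when-∃≡∑ : {P : X → Set} (P? : ∀ x → Dec (P x)) (∃P? : Dec (∃ P)) → (∀ x y → P x → P y → x ≡ y) →
               ∀ a → when ∃P? a ≡ ∑[ x ∈ xs ] when (P? x) a
    when-∃≡∑ P? (yes (z , pz)) atMostOne a =
      sym (∑-when-unique P? _ xs! (complete z) pz (λ x px → atMostOne x z px pz))
    when-∃≡∑ P? (no ¬∃P) _ a = sym (∑-when-none P? _ xs (λ {x} _ px → ¬∃P (x , px)))

    ∃? : {P : X → Set} → (∀ x → Dec (P x)) → Dec (∃ P)
    ∃? P? with any? P? xs
    ... | yes ∃x∈xs = yes (satisfied ∃x∈xs)
    ... | no  ∄x∈xs = no λ (x , px) → ∄x∈xs (lose (complete x) px)

    ∑-bijection : ∀ (σ τ : X → X) → (∀ x → τ (σ x) ≡ x) → (∀ y → σ (τ y) ≡ y) →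
                  ∀ (f : X → A) → ∑[ x ∈ xs ] f (σ x) ≡ ∑ xs f
    ∑-bijection σ τ τσ στ f = begin
      ∑[ x ∈ xs ] f (σ x)                           ≡⟨ ∑-cong xs (λ x → sym (∑-when-≡ f (σ x))) ⟩
      ∑[ x ∈ xs ] ∑[ y ∈ xs ] when (y ≟ σ x) (f y)  ≡⟨ ∑-swap xs xs _ ⟩
      ∑[ y ∈ xs ] ∑[ x ∈ xs ] when (y ≟ σ x) (f y)  ≡⟨ ∑-cong xs (λ y → ∑-when-unique (λ x → y ≟ σ x) (λ _ → f y)
                                                          xs! (complete (τ y)) (sym (στ y))
                                                          (λ x y≡σx → trans (sym (τσ x)) (cong τ (sym y≡σx)))) ⟩
      ∑ xs f                                        ∎
      where open ≡-Reasoning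


module RingSum {A : Set} {_+_ _*_ : A → A → A} { -_ : A → A} {0# 1# : A}
               (isCommutativeRing : IsCommutativeRing _≡_ _+_ _*_ -_ 0# 1#) where

  commutativeRing : CommutativeRing _ _
  commutativeRing = record { isCommutativeRing = isCommutativeRing }

  open CommutativeRing commutativeRing
    using (+-isCommutativeMonoid; zeroˡ; zeroʳ; distribˡ; distribʳ; *-identityˡ; semiring)
  open ListSum +-isCommutativeMonoid public
  open import Algebra.Properties.Semiring.Mult semiring public
    using (×-homo-+; ×1-homo-*) renaming (_×_ to _×ₙ_)

  ι : ℕ → A
  ι n = n ×ₙ 1#

  ι-+ : ∀ m n → ι (m ℕ.+ n) ≡ ι m + ι n
  ι-+ = ×-homo-+ 1#

  ι-* : ∀ m n → ι (m ℕ.* n) ≡ ι m * ι n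
  ι-* = ×1-homo-*

  module _ {X : Set} where

    ∑-distribˡ : ∀ (xs : List X) r f → r * ∑ xs f ≡ ∑[ x ∈ xs ] (r * f x)
    ∑-distribˡ []       r _ = zeroʳ r
    ∑-distribˡ (x ∷ xs) r f = trans (distribˡ r _ _) (cong (_ +_) (∑-distribˡ xs r f))

    ∑-const : ∀ (xs : List X) c → ∑[ x ∈ xs ] c ≡ ι (length xs) * c
    ∑-const []       c = sym (zeroˡ c)
    ∑-const (x ∷ xs) c = trans (cong₂ _+_ (sym (*-identityˡ c)) (∑-const xs c)) (sym (distribʳ c _ _))

  module _ {P : Set} where

    when-distribˡ : (p : Dec P) → ∀ r a → when p (r * a) ≡ r * when p a
    when-distribˡ (yes _) _ _ = refl
    when-distribˡ (no _)  r _ = sym (zeroʳ r)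


module NatSolver = Data.Nat.Solver.+-*-Solver


module UniqueList {X : Set} where

  Unique⇒length≤ : {xs ys : List X} → Unique xs → xs ⊆ ys → length xs ℕ.≤ length ys
  Unique⇒length≤ {[]}     _            _     = ℕ.z≤n
  Unique⇒length≤ {x ∷ xs} (x∉xs ∷ xs!) xs⊆ys with ∈-∃++ (xs⊆ys (here refl))
  ... | us , vs , refl =
    ℕₚ.≤-trans (ℕ.s≤s (Unique⇒length≤ xs! xs⊆us++vs)) (ℕₚ.≤-reflexive (sym (length-++-sucʳ us x vs)))
    where
    xs⊆us++vs : xs ⊆ us ++ vs
    xs⊆us++vs z∈xs with ∈-++⁻ us (xs⊆ys (there z∈xs))
    ... | inj₁ z∈us         = ∈-++⁺ˡ z∈us
    ... | inj₂ (here refl)  = contradiction refl (All.lookup x∉xs z∈xs)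
    ... | inj₂ (there z∈vs) = ∈-++⁺ʳ us z∈vs

  pigeonhole : DecidableEquality X → {xs ys : List X} → Unique xs → xs ⊆ ys →
               length ys ℕ.≤ length xs → ys ⊆ xs
  pigeonhole _≟_ {xs} {ys} xs! xs⊆ys |ys|≤|xs| {y} y∈ys with y ∈? xs
    where open import Data.List.Membership.DecPropositional _≟_ using (_∈?_)
  ... | yes y∈xs = y∈xs
  ... | no  y∉xs = contradiction (ℕₚ.≤-trans (Unique⇒length≤ y∷xs! y∷xs⊆ys) |ys|≤|xs|) ℕₚ.1+n≰n
    where
    y∷xs! : Unique (y ∷ xs)
    y∷xs! = All.tabulate (λ z∈xs y≡z → y∉xs (subst (_∈ xs) (sym y≡z) z∈xs)) ∷ xs!
    y∷xs⊆ys : y ∷ xs ⊆ ys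
    y∷xs⊆ys (here refl)  = y∈ys
    y∷xs⊆ys (there z∈xs) = xs⊆ys z∈xs

  Unique-map⁺-injectiveOn : {Y : Set} (f : X → Y) {xs : List X} → Unique xs →
                (∀ {x y} → x ∈ xs → y ∈ xs → f x ≡ f y → x ≡ y) → Unique (map f xs)
  Unique-map⁺-injectiveOn f {[]}     _            _   = []
  Unique-map⁺-injectiveOn f {x ∷ xs} (x∉xs ∷ xs!) inj =
    All-map⁺ (All.tabulate (λ y∈xs fx≡fy → All.lookup x∉xs y∈xs (inj (here refl) (there y∈xs) fx≡fy)))
    ∷ Unique-map⁺-injectiveOn f xs! (λ x∈xs y∈xs → inj (there x∈xs) (there y∈xs))

  length-cartesianProduct : {Y : Set} (xs : List X) (ys : List Y) →
                            length (cartesianProduct xs ys) ≡ length xs ℕ.* length ys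
  length-cartesianProduct []       ys = refl
  length-cartesianProduct (x ∷ xs) ys =
    trans (length-++ (map (x ,_) ys)) (cong₂ ℕ._+_ (length-map (x ,_) ys) (length-cartesianProduct xs ys))


  Unique⇒length-filter-≢ : (_≟_ : DecidableEquality X) {xs : List X} {z : X} → Unique xs → z ∈ xs →
                           suc (length (filter (λ y → ¬? (y ≟ z)) xs)) ≡ length xs
  Unique⇒length-filter-≢ _≟_ {y ∷ ys} {z} (y∉ys ∷ ys!) (here refl) with y ≟ y
  ... | no  y≢y = contradiction refl y≢y
  ... | yes _   = cong (suc ∘ length) (filter-all (λ y → ¬? (y ≟ z)) (All.map (λ y≢x x≡y → y≢x (sym x≡y)) y∉ys))
  Unique⇒length-filter-≢ _≟_ {y ∷ ys} {z} (y∉ys ∷ ys!) (there z∈ys) with y ≟ z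
  ... | yes refl = contradiction refl (All.lookup y∉ys z∈ys)
  ... | no  _    = cong suc (Unique⇒length-filter-≢ _≟_ ys! z∈ys)

module PrimeBinomial where

  open import Data.Nat
  open import Data.Nat.Properties
  open import Data.Nat.Divisibility
  open import Data.Nat.DivMod using (m/n*n≡m)
  open import Data.Nat.Primality using (Prime; euclidsLemma; ¬prime[1])
  open import Data.Nat.Combinatorics using (_C_; k![n∸k]!∣n!)
  open import Data.Nat.Combinatorics.Specification using (nCk≡n!/k![n-k]!)

  p∤j! : ∀ {p} → Prime p → ∀ {j} → j < p → ¬ p ∣ j !
  p∤j! pp {zero}  _   p∣1 = ¬prime[1] (subst Prime (∣1⇒≡1 p∣1) pp)
  p∤j! pp {suc j} j<p p∣j! with euclidsLemma (suc j) (j !) pp p∣j!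
  ... | inj₁ p∣1+j = <⇒≱ j<p (∣⇒≤ p∣1+j)
  ... | inj₂ p∣j!  = p∤j! pp (<-trans (n<1+n j) j<p) p∣j!

  p∣pCk : ∀ {p k} → Prime p → 0 < k → k < p → p ∣ p C k
  p∣pCk {p@(suc p-1)} {k} pp 0<k k<p with euclidsLemma (p C k) (k ! * (p ∸ k) !) pp p∣pCk*k!*[p∸k]!
    where
    instance _ = k !* (p ∸ k) !≢0
    pCk*k!*[p∸k]!≡p! : (p C k) * (k ! * (p ∸ k) !) ≡ p !
    pCk*k!*[p∸k]!≡p! = trans (cong (_* (k ! * (p ∸ k) !)) (nCk≡n!/k![n-k]! (<⇒≤ k<p)))
                             (m/n*n≡m (k![n∸k]!∣n! (<⇒≤ k<p)))
    p∣pCk*k!*[p∸k]! : p ∣ (p C k) * (k ! * (p ∸ k) !)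
    p∣pCk*k!*[p∸k]! = subst (p ∣_) (sym pCk*k!*[p∸k]!≡p!) (divides (p-1 !) (*-comm p (p-1 !)))
  ... | inj₁ p∣pCk = p∣pCk
  ... | inj₂ p∣k!*[p∸k]! with euclidsLemma (k !) ((p ∸ k) !) pp p∣k!*[p∸k]!
  ...   | inj₁ p∣k!     = contradiction p∣k! (p∤j! pp k<p)
  ...   | inj₂ p∣[p∸k]! = contradiction p∣[p∸k]! (p∤j! pp (∸-monoʳ-< 0<k (<⇒≤ k<p)))



module FiniteFieldTheory (F : FiniteField) where

  open FiniteField F public
  open IsCommutativeRing isCommutativeRing public
    using (+-assoc; +-comm; +-identityˡ; +-identityʳ; -‿inverseˡ; -‿inverseʳ;
           *-assoc; *-comm; *-identityˡ; *-identityʳ; distribˡ; distribʳ; zeroˡ; zeroʳ; *-isCommutativeMonoid)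
  private
    module FieldSum = RingSum isCommutativeRing
  open FieldSum
  open FieldSum public using (ι; ι-*)
  open import Algebra.Properties.Ring (CommutativeRing.ring commutativeRing) public
    using (+-cancelˡ; +-cancelʳ; +-inverseˡ-unique; x∙y⁻¹≈ε⇒x≈y; -‿involutive; -0#≈0#;
           -‿distribˡ-*; -‿distribʳ-*; -‿+-comm; -1*x≈-x; x≈z//y; //-rightDividesˡ; //-rightDividesʳ;
           \\-leftDividesˡ; \\-leftDividesʳ)
  open CommutativeRing commutativeRing public
    using (commutativeSemiring; semiring; +-commutativeSemigroup; *-commutativeSemigroup)
  open import Algebra.Properties.CommutativeSemiring.Exp commutativeSemiring
    using (^-homo-*; ^-assocʳ; ^-distrib-*) renaming (_^_ to _^ₛ_)
  module SemiringSolver = Algebra.Solver.Ring.NaturalCoefficients.Default commutativeSemiring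
  open SemiringSolver using (solve; _:+_; _:*_; _:=_)
  open Enumeration _≟_ elements unique complete

  inv : ∀ x → x ≢ 0# → Carrier
  inv x x≢0 = proj₁ (inverse x x≢0)

  module _ {x : Carrier} (x≢0 : x ≢ 0#) where

    inv-inverseʳ : x * inv x x≢0 ≡ 1#
    inv-inverseʳ = proj₂ (inverse x x≢0)

    inv-inverseˡ : inv x x≢0 * x ≡ 1#
    inv-inverseˡ = trans (*-comm _ x) inv-inverseʳ

    inv-cancelˡ : ∀ y → inv x x≢0 * (x * y) ≡ y
    inv-cancelˡ y = trans (sym (*-assoc _ x y)) (trans (cong (_* y) inv-inverseˡ) (*-identityˡ y))

    inv-cancelʳ : ∀ y → x * (inv x x≢0 * y) ≡ y
    inv-cancelʳ y = trans (sym (*-assoc x _ y)) (trans (cong (_* y) inv-inverseʳ) (*-identityˡ y))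

    inv≢0 : inv x x≢0 ≢ 0#
    inv≢0 x⁻¹≡0 = 0≢1 (trans (sym (zeroʳ x)) (trans (cong (x *_) (sym x⁻¹≡0)) inv-inverseʳ))

  x*y≡0⇒x≡0⊎y≡0 : ∀ x y → x * y ≡ 0# → x ≡ 0# ⊎ y ≡ 0#
  x*y≡0⇒x≡0⊎y≡0 x y xy≡0 with x ≟ 0#
  ... | yes x≡0 = inj₁ x≡0
  ... | no  x≢0 = inj₂ (trans (sym (inv-cancelˡ x≢0 y)) (trans (cong (inv x x≢0 *_) xy≡0) (zeroʳ _)))

  *-≢0 : ∀ {x y} → x ≢ 0# → y ≢ 0# → x * y ≢ 0#
  *-≢0 {x} {y} x≢0 y≢0 xy≡0 = [ x≢0 , y≢0 ]′ (x*y≡0⇒x≡0⊎y≡0 x y xy≡0)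

  *-cancelˡ : ∀ x {y z} → x ≢ 0# → x * y ≡ x * z → y ≡ z
  *-cancelˡ x {y} {z} x≢0 xy≡xz with x*y≡0⇒x≡0⊎y≡0 x (y - z) x[y-z]≡0
    where
    x[y-z]≡0 : x * (y - z) ≡ 0#
    x[y-z]≡0 = trans (distribˡ x y (- z))
                     (trans (cong₂ _+_ xy≡xz (sym (-‿distribʳ-* x z))) (-‿inverseʳ (x * z)))
  ... | inj₁ x≡0   = contradiction x≡0 x≢0
  ... | inj₂ y-z≡0 = x∙y⁻¹≈ε⇒x≈y y z y-z≡0

  *-cancelʳ : ∀ {x y} z → z ≢ 0# → x * z ≡ y * z → x ≡ y
  *-cancelʳ {x} {y} z z≢0 xz≡yz = *-cancelˡ z z≢0 (trans (*-comm z x) (trans xz≡yz (*-comm y z)))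

  x-[x-y]≡y : ∀ x y → x - (x - y) ≡ y
  x-[x-y]≡y x y = begin
    x + - (x + - y)      ≡⟨ cong (x +_) (sym (-‿+-comm x (- y))) ⟩
    x + (- x + - - y)    ≡⟨ \\-leftDividesˡ x (- - y) ⟩
    - - y                ≡⟨ -‿involutive y ⟩
    y                    ∎
    where open ≡-Reasoning

  x-y≡z+w⇒x-z≡y+w : ∀ {x y z w} → x - y ≡ z + w → x - z ≡ y + w
  x-y≡z+w⇒x-z≡y+w {x} {y} {z} {w} x-y≡z+w = sym (x≈z//y (y + w) z x (begin
    (y + w) + z      ≡⟨ solve 3 (λ y w z → (y :+ w) :+ z := z :+ w :+ y) refl y w z ⟩
    z + w + y        ≡⟨ cong (_+ y) (sym x-y≡z+w) ⟩
    (x - y) + y      ≡⟨ //-rightDividesˡ y x ⟩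
    x                ∎))
    where open ≡-Reasoning

  ^≡^ₛ : ∀ x n → x ^ n ≡ x ^ₛ n
  ^≡^ₛ x zero    = refl
  ^≡^ₛ x (suc n) = cong (x *_) (^≡^ₛ x n)

  ^-+ : ∀ x m n → x ^ (m ℕ.+ n) ≡ x ^ m * x ^ n
  ^-+ x m n = trans (^≡^ₛ x (m ℕ.+ n)) (trans (^-homo-* x m n) (sym (cong₂ _*_ (^≡^ₛ x m) (^≡^ₛ x n))))

  ^-* : ∀ x m n → x ^ (m ℕ.* n) ≡ (x ^ m) ^ n
  ^-* x m n = trans (^≡^ₛ x (m ℕ.* n)) (trans (sym (^-assocʳ x m n))
                                      (sym (trans (^≡^ₛ (x ^ m) n) (cong (_^ₛ n) (^≡^ₛ x m)))))

  *-^ : ∀ x y n → (x * y) ^ n ≡ x ^ n * y ^ n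
  *-^ x y n = trans (^≡^ₛ _ n) (trans (^-distrib-* x y n) (sym (cong₂ _*_ (^≡^ₛ x n) (^≡^ₛ y n))))

  1^ : ∀ n → 1# ^ n ≡ 1#
  1^ zero    = refl
  1^ (suc n) = trans (*-identityˡ _) (1^ n)

  ^≡0⇒≡0 : ∀ x n → x ^ n ≡ 0# → x ≡ 0#
  ^≡0⇒≡0 x zero    1≡0 = contradiction (sym 1≡0) 0≢1
  ^≡0⇒≡0 x (suc n) xⁿ⁺¹≡0 = [ id , ^≡0⇒≡0 x n ]′ (x*y≡0⇒x≡0⊎y≡0 x (x ^ n) xⁿ⁺¹≡0)

  ι-^ : ∀ m n → ι (m ℕ.^ n) ≡ ι m ^ n
  ι-^ m zero    = +-identityʳ 1#
  ι-^ m (suc n) = trans (ι-* m (m ℕ.^ n)) (cong (ι m *_) (ι-^ m n))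

  units : List Carrier
  units = filter (λ x → ¬? (x ≟ 0#)) elements

  1+|units|≡order : suc (length units) ≡ order
  1+|units|≡order = UniqueList.Unique⇒length-filter-≢ _≟_ unique (complete 0#)

  -- Lagrange: y ↦ x * y permutes the units; `unit` replaces 0# by 1# so that the product can
  -- be taken over all elements.
  x^|units|≡1 : ∀ {x} → x ≢ 0# → x ^ length units ≡ 1#
  x^|units|≡1 {x} x≢0 = *-cancelʳ U U≢0 (begin
    x ^ length units * U
      ≡⟨ cong (_* U) (sym (∏-const units)) ⟩
    Π.∑ units (λ _ → x) * U
      ≡⟨ cong (_* U) (Π.∑-filter (λ y → ¬? (y ≟ 0#)) elements _) ⟩
    Π.∑ elements (λ y → Π.when (y ≢0?) x) * U
      ≡⟨ sym (Π.∑-∙ elements _ unit) ⟩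
    Π.∑ elements (λ y → Π.when (y ≢0?) x * unit y)
      ≡⟨ Π.∑-cong elements (λ y → sym (Π.when-∙ (y ≢0?) x y)) ⟩
    Π.∑ elements (λ y → Π.when (y ≢0?) (x * y))
      ≡⟨ Π.∑-cong elements (λ y → Π.when-⇔ (y ≢0?) ((x * y) ≢0?)
           (*-≢0 x≢0) (λ xy≢0 → xy≢0 ∘ x*0≡0) _) ⟩
    Π.∑ elements (λ y → unit (x * y))
      ≡⟨ ∏-bijection (x *_) (inv x x≢0 *_) (inv-cancelˡ x≢0) (inv-cancelʳ x≢0) unit ⟩
    U
      ≡⟨ sym (*-identityˡ U) ⟩
    1# * U ∎)
    where
    open ≡-Reasoning
    module Π = ListSum *-isCommutativeMonoid
    open Π.Enumeration _≟_ elements unique complete using () renaming (∑-bijection to ∏-bijection)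
    _≢0? : ∀ y → Dec (y ≢ 0#)
    y ≢0? = ¬? (y ≟ 0#)
    x*0≡0 : ∀ {y} → y ≡ 0# → x * y ≡ 0#
    x*0≡0 refl = zeroʳ x
    unit : Carrier → Carrier
    unit y = Π.when (y ≢0?) y
    U = Π.∑ elements unit
    ∏unit≢0 : ∀ ys → Π.∑ ys unit ≢ 0#
    ∏unit≢0 []       = 0≢1 ∘ sym
    ∏unit≢0 (y ∷ ys) with y ≟ 0#
    ... | yes _   = ∏unit≢0 ys ∘ trans (sym (*-identityˡ _))
    ... | no  y≢0 = *-≢0 y≢0 (∏unit≢0 ys)
    U≢0 : U ≢ 0#
    U≢0 = ∏unit≢0 elements
    ∏-const : ∀ ys → Π.∑ ys (λ _ → x) ≡ x ^ length ys
    ∏-const []       = refl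
    ∏-const (_ ∷ ys) = cong (x *_) (∏-const ys)

  x^order≡x : ∀ x → x ^ order ≡ x
  x^order≡x x with x ≟ 0#
  ... | yes refl = subst (λ n → 0# ^ n ≡ 0#) 1+|units|≡order (zeroˡ _)
  ... | no  x≢0  = subst (λ n → x ^ n ≡ x) 1+|units|≡order
                         (trans (cong (x *_) (x^|units|≡1 x≢0)) (*-identityʳ x))

  ι-order≡0 : ι order ≡ 0#
  ι-order≡0 = +-cancelʳ S (ι order) 0# (begin
    ι order + S
      ≡⟨ cong (_+ S) (sym (*-identityʳ (ι order))) ⟩
    ι order * 1# + S
      ≡⟨ cong (_+ S) (sym (∑-const elements 1#)) ⟩
    ∑[ y ∈ elements ] 1# + S
      ≡⟨ sym (∑-∙ elements (λ _ → 1#) id) ⟩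
    ∑[ y ∈ elements ] (1# + y)
      ≡⟨ ∑-bijection (1# +_) (- 1# +_) (\\-leftDividesʳ 1#) (\\-leftDividesˡ 1#) id ⟩
    S
      ≡⟨ sym (+-identityˡ S) ⟩
    0# + S ∎)
    where
    open ≡-Reasoning
    S = ∑ elements id

  -- `monic cs` is the monic polynomial c₀ + c₁ x + ⋯ + x ^ length cs with cs = c₀ ∷ c₁ ∷ ⋯
  monic : List Carrier → Carrier → Carrier
  monic []       x = 1#
  monic (c ∷ cs) x = c + x * monic cs x

  quotient : Carrier → Carrier → List Carrier → List Carrier
  quotient r c []        = []
  quotient r c (c′ ∷ cs) = monic (c′ ∷ cs) r ∷ quotient r c′ cs

  length-quotient : ∀ r c cs → length (quotient r c cs) ≡ length cs
  length-quotient r c []        = refl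
  length-quotient r c (c′ ∷ cs) = cong suc (length-quotient r c′ cs)

  -- The solver works over semirings only: x is written as (x - r) + r, with x - r an atom.
  remainder-theorem : ∀ r c cs x → monic (c ∷ cs) x ≡ (x - r) * monic (quotient r c cs) x + monic (c ∷ cs) r
  remainder-theorem r c []        x = begin
    c + x * 1#
      ≡⟨ cong (λ y → c + y * 1#) (sym (//-rightDividesˡ r x)) ⟩
    c + ((x - r) + r) * 1#
      ≡⟨ solve 4 (λ c d r one → c :+ (d :+ r) :* one := d :* one :+ (c :+ r :* one))
                 refl c (x - r) r 1# ⟩
    (x - r) * 1# + (c + r * 1#) ∎
    where open ≡-Reasoning
  remainder-theorem r c (c′ ∷ cs) x = begin
    c + x * P x
      ≡⟨ cong (λ z → c + x * z) (remainder-theorem r c′ cs x) ⟩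
    c + x * ((x - r) * Q + P r)
      ≡⟨ cong (λ y → c + y * ((x - r) * Q + P r)) (sym (//-rightDividesˡ r x)) ⟩
    c + ((x - r) + r) * ((x - r) * Q + P r)
      ≡⟨ solve 5 (λ c d r Q Pr → c :+ (d :+ r) :* (d :* Q :+ Pr)
                  := d :* (Pr :+ (d :+ r) :* Q) :+ (c :+ r :* Pr)) refl c (x - r) r Q (P r) ⟩
    (x - r) * (P r + ((x - r) + r) * Q) + (c + r * P r)
      ≡⟨ cong (λ y → (x - r) * (P r + y * Q) + (c + r * P r)) (//-rightDividesˡ r x) ⟩
    (x - r) * (P r + x * Q) + (c + r * P r) ∎
    where
    open ≡-Reasoning
    P = monic (c′ ∷ cs)
    Q = monic (quotient r c′ cs) x

  roots≤degree : ∀ cs {rs} → Unique rs → (∀ {r} → r ∈ rs → monic cs r ≡ 0#) → length rs ℕ.≤ length cs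
  roots≤degree cs       {[]}     _            _     = ℕ.z≤n
  roots≤degree []       {r ∷ _}  _            roots = contradiction (sym (roots (here refl))) 0≢1
  roots≤degree (c ∷ cs) {r ∷ rs} (r∉rs ∷ rs!) roots =
    ℕ.s≤s (subst (length rs ℕ.≤_) (length-quotient r c cs) (roots≤degree (quotient r c cs) rs! quotient-roots))
    where
    quotient-roots : ∀ {r′} → r′ ∈ rs → monic (quotient r c cs) r′ ≡ 0#
    quotient-roots {r′} r′∈rs with x*y≡0⇒x≡0⊎y≡0 (r′ - r) (monic (quotient r c cs) r′) (begin
      (r′ - r) * monic (quotient r c cs) r′
        ≡⟨ sym (+-identityʳ _) ⟩
      (r′ - r) * monic (quotient r c cs) r′ + 0#
        ≡⟨ cong ((r′ - r) * monic (quotient r c cs) r′ +_) (sym (roots (here refl))) ⟩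
      (r′ - r) * monic (quotient r c cs) r′ + monic (c ∷ cs) r
        ≡⟨ sym (remainder-theorem r c cs r′) ⟩
      monic (c ∷ cs) r′
        ≡⟨ roots (there r′∈rs) ⟩
      0# ∎)
      where open ≡-Reasoning
    ... | inj₁ r′-r≡0 = contradiction (sym (x∙y⁻¹≈ε⇒x≈y r′ r r′-r≡0)) (All.lookup r∉rs r′∈rs)
    ... | inj₂ q[r′]≡0 = q[r′]≡0

  monic-0s : ∀ n x → monic (replicate n 0#) x ≡ x ^ n
  monic-0s zero    x = refl
  monic-0s (suc n) x = trans (+-identityˡ _) (cong (x *_) (monic-0s n x))

  roots-xⁿ⁺¹≡c : ∀ n c {rs} → Unique rs → (∀ {r} → r ∈ rs → r ^ suc n ≡ c) → length rs ℕ.≤ suc n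
  roots-xⁿ⁺¹≡c n c {rs} rs! roots =
    subst (length rs ℕ.≤_) (cong suc (length-replicate n)) (roots≤degree (- c ∷ replicate n 0#) rs! root)
    where
    root : ∀ {r} → r ∈ rs → monic (- c ∷ replicate n 0#) r ≡ 0#
    root {r} r∈rs = trans (cong (λ z → - c + r * z) (monic-0s n r))
                          (trans (cong (- c +_) (roots r∈rs)) (-‿inverseˡ c))

  roots-xⁿ⁺²≡sx : ∀ n s {rs} → Unique rs → (∀ {r} → r ∈ rs → r ^ suc (suc n) ≡ s * r) → length rs ℕ.≤ suc (suc n)
  roots-xⁿ⁺²≡sx n s {rs} rs! roots =
    subst (length rs ℕ.≤_) (cong (suc ∘ suc) (length-replicate n))
          (roots≤degree (0# ∷ - s ∷ replicate n 0#) rs! root)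
    where
    root : ∀ {r} → r ∈ rs → monic (0# ∷ - s ∷ replicate n 0#) r ≡ 0#
    root {r} r∈rs = begin
      0# + r * (- s + r * monic (replicate n 0#) r)   ≡⟨ cong (λ z → 0# + r * (- s + r * z)) (monic-0s n r) ⟩
      0# + r * (- s + r * r ^ n)                      ≡⟨ +-identityˡ _ ⟩
      r * (- s + r * r ^ n)                           ≡⟨ distribˡ r (- s) _ ⟩
      r * - s + r ^ suc (suc n)                       ≡⟨ cong₂ _+_ (sym (-‿distribʳ-* r s)) (roots r∈rs) ⟩
      - (r * s) + s * r                               ≡⟨ cong (λ z → - z + s * r) (*-comm r s) ⟩
      - (s * r) + s * r                               ≡⟨ -‿inverseˡ (s * r) ⟩
      0#                                              ∎
      where open ≡-Reasoning

  module Frobenius {p : ℕ} (p-prime : Prime p) (ι-p≡0 : ι p ≡ 0#) where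

    open import Algebra.Properties.CommutativeSemiring.Binomial commutativeSemiring
      using (theorem; binomialTerm; binomial)
    open import Algebra.Properties.Semiring.Sum semiring using (sum)
    open import Algebra.Properties.Semiring.Mult semiring using (×-assoc-*)

    ×≡ι* : ∀ m x → m ×ₙ x ≡ ι m * x
    ×≡ι* m x = trans (cong (m ×ₙ_) (sym (*-identityˡ x))) (sym (×-assoc-* m 1# x))

    sum≡last : ∀ m (f : Fin (suc m) → Carrier) → (∀ j → toℕ j ℕ.< m → f j ≡ 0#) → sum f ≡ f (fromℕ m)
    sum≡last zero    f _        = +-identityʳ _
    sum≡last (suc m) f init≡0 =
      trans (cong₂ _+_ (init≡0 Fin.zero ℕ.z<s)
                       (sum≡last m (f ∘ Fin.suc) (λ j j<m → init≡0 (Fin.suc j) (ℕ.s≤s j<m))))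
            (+-identityˡ _)

    freshmans-dream : ∀ n .{{_ : ℕ.NonZero n}} → (∀ {k} → 0 ℕ.< k → k ℕ.< n → ι (n C k) ≡ 0#) →
                      ∀ x y → (x + y) ^ n ≡ x ^ n + y ^ n
    freshmans-dream (suc m) ι-nCk≡0 x y = begin
      (x + y) ^ suc m
        ≡⟨ ^≡^ₛ (x + y) (suc m) ⟩
      (x + y) ^ₛ suc m
        ≡⟨ theorem (suc m) x y ⟩
      binomialTerm x y (suc m) Fin.zero + sum (binomialTerm x y (suc m) ∘ Fin.suc)
        ≡⟨ cong₂ _+_ first (sum≡last m _ middle≡0) ⟩
      y ^ suc m + binomialTerm x y (suc m) (Fin.suc (fromℕ m))
        ≡⟨ cong (y ^ suc m +_) last ⟩
      y ^ suc m + x ^ suc m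
        ≡⟨ +-comm _ _ ⟩
      x ^ suc m + y ^ suc m ∎
      where
      open ≡-Reasoning
      first : binomialTerm x y (suc m) Fin.zero ≡ y ^ suc m
      first = trans (+-identityʳ _) (trans (*-identityˡ _) (sym (^≡^ₛ y (suc m))))
      middle≡0 : ∀ j → toℕ j ℕ.< m → binomialTerm x y (suc m) (Fin.suc j) ≡ 0#
      middle≡0 j j<m = begin
        binomialTerm x y (suc m) (Fin.suc j)                        ≡⟨ ×≡ι* (suc m C suc (toℕ j)) b ⟩
        ι (suc m C suc (toℕ j)) * b                                 ≡⟨ cong (_* b) (ι-nCk≡0 ℕ.z<s (ℕ.s≤s j<m)) ⟩
        0# * b                                                      ≡⟨ zeroˡ b ⟩
        0#                                                          ∎
        where b = binomial x y (suc m) (Fin.suc j)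
      last : binomialTerm x y (suc m) (Fin.suc (fromℕ m)) ≡ x ^ suc m
      last rewrite toℕ-fromℕ m | nCn≡1 (suc m) | ℕₚ.n∸n≡0 m =
        trans (+-identityʳ _) (trans (*-identityʳ _) (sym (^≡^ₛ x (suc m))))

    ι-pCk≡0 : ∀ {k} → 0 ℕ.< k → k ℕ.< p → ι (p C k) ≡ 0#
    ι-pCk≡0 0<k k<p with PrimeBinomial.p∣pCk p-prime 0<k k<p
    ... | divides c pCk≡c*p = trans (cong ι pCk≡c*p) (trans (ι-* c p) (trans (cong (ι c *_) ι-p≡0) (zeroʳ _)))

    ^pⁿ-+ : ∀ n x y → (x + y) ^ (p ℕ.^ n) ≡ x ^ (p ℕ.^ n) + y ^ (p ℕ.^ n)
    ^pⁿ-+ zero    x y = trans (*-identityʳ _) (sym (cong₂ _+_ (*-identityʳ x) (*-identityʳ y)))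
    ^pⁿ-+ (suc n) x y = begin
      (x + y) ^ (p ℕ.* p ℕ.^ n)
        ≡⟨ ^-* (x + y) p (p ℕ.^ n) ⟩
      ((x + y) ^ p) ^ (p ℕ.^ n)
        ≡⟨ cong (_^ (p ℕ.^ n)) (freshmans-dream p {{prime⇒nonZero p-prime}} ι-pCk≡0 x y) ⟩
      (x ^ p + y ^ p) ^ (p ℕ.^ n)
        ≡⟨ ^pⁿ-+ n (x ^ p) (y ^ p) ⟩
      (x ^ p) ^ (p ℕ.^ n) + (y ^ p) ^ (p ℕ.^ n)
        ≡⟨ sym (cong₂ _+_ (^-* x p (p ℕ.^ n)) (^-* y p (p ℕ.^ n))) ⟩
      x ^ (p ℕ.* p ℕ.^ n) + y ^ (p ℕ.* p ℕ.^ n) ∎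
      where open ≡-Reasoning

  Square : Carrier → Set
  Square = IsNonzeroSquare F

  square? : ∀ x → Dec (Square x)
  square? = isNonzeroSquare? F

  squares : List Carrier
  squares = filter square? elements

  Square-* : ∀ {x y} → Square x → Square y → Square (x * y)
  Square-* (a , a≢0 , refl) (b , b≢0 , refl) = a * b , *-≢0 a≢0 b≢0 , interchange a b a b
    where open import Algebra.Properties.CommutativeSemigroup *-commutativeSemigroup using (interchange)

  Square⇒≢0 : ∀ {x} → Square x → x ≢ 0#
  Square⇒≢0 (a , a≢0 , refl) = *-≢0 a≢0 a≢0

  -y*-y≡y*y : ∀ y → - y * - y ≡ y * y
  -y*-y≡y*y y = trans (sym (-‿distribˡ-* y (- y)))
                      (trans (cong -_ (sym (-‿distribʳ-* y y))) (-‿involutive (y * y)))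

  ι2*x≡x+x : ∀ x → ι 2 * x ≡ x + x
  ι2*x≡x+x x = trans (distribʳ x 1# (1# + 0#))
                     (cong₂ _+_ (*-identityˡ x) (trans (cong (_* x) (+-identityʳ 1#)) (*-identityˡ x)))

  module OddCharacteristic (ι2≢0 : ι 2 ≢ 0#) where

    x+x≡y+y⇒x≡y : ∀ {x y} → x + x ≡ y + y → x ≡ y
    x+x≡y+y⇒x≡y {x} {y} 2x≡2y = *-cancelˡ (ι 2) ι2≢0 (trans (ι2*x≡x+x x) (trans 2x≡2y (sym (ι2*x≡x+x y))))

    x+x≡0⇒x≡0 : ∀ {x} → x + x ≡ 0# → x ≡ 0#
    x+x≡0⇒x≡0 x+x≡0 = x+x≡y+y⇒x≡y (trans x+x≡0 (sym (+-identityʳ 0#)))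

    x≢0⇒x≢-x : ∀ {x} → x ≢ 0# → x ≢ - x
    x≢0⇒x≢-x {x} x≢0 x≡-x = x≢0 (x+x≡0⇒x≡0 (trans (cong (x +_) x≡-x) (-‿inverseʳ x)))

    x²≡y²⇒x≡±y : ∀ x y → x * x ≡ y * y → x ≡ y ⊎ x ≡ - y
    x²≡y²⇒x≡±y x y x²≡y² with x*y≡0⇒x≡0⊎y≡0 (x - y) (x + y) (+-cancelʳ (y * y) _ _ (begin
      (x - y) * (x + y) + y * y
        ≡⟨ cong (λ z → (x - y) * (z + y) + y * y) (sym (//-rightDividesˡ y x)) ⟩
      (x - y) * ((x - y) + y + y) + y * y
        ≡⟨ solve 2 (λ d y → d :* (d :+ y :+ y) :+ y :* y := (d :+ y) :* (d :+ y)) refl (x - y) y ⟩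
      ((x - y) + y) * ((x - y) + y)
        ≡⟨ cong (λ z → z * z) (//-rightDividesˡ y x) ⟩
      x * x
        ≡⟨ trans x²≡y² (sym (+-identityˡ (y * y))) ⟩
      0# + y * y ∎))
      where open ≡-Reasoning
    ... | inj₁ x-y≡0 = inj₁ (x∙y⁻¹≈ε⇒x≈y x y x-y≡0)
    ... | inj₂ x+y≡0 = inj₂ (+-inverseˡ-unique x y x+y≡0)

    private
      module ℕΣ = ListSum ℕₚ.+-0-isCommutativeMonoid

    length≡ℕΣ : ∀ {X : Set} (xs : List X) → length xs ≡ ℕΣ.∑ xs (λ _ → 1)
    length≡ℕΣ []       = refl
    length≡ℕΣ (_ ∷ xs) = cong suc (length≡ℕΣ xs)

    ℕΣ-const : ∀ {X : Set} (xs : List X) c → ℕΣ.∑ xs (λ _ → c) ≡ length xs ℕ.* c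
    ℕΣ-const []       c = refl
    ℕΣ-const (_ ∷ xs) c = cong (c ℕ.+_) (ℕΣ-const xs c)

    square-roots : ∀ s → ℕΣ.∑ elements (λ x → ℕΣ.when (¬? (x ≟ 0#) ×-dec (s ≟ (x * x))) 1) ≡ ℕΣ.when (square? s) 2
    square-roots s with square? s
    ... | no ¬□s = ℕΣ.∑-when-none (λ x → ¬? (x ≟ 0#) ×-dec (s ≟ (x * x))) _ elements
                     (λ {x} _ (x≢0 , s≡x²) → ¬□s (x , x≢0 , sym s≡x²))
    ... | yes (y , y≢0 , y²≡s) = begin
      ℕΣ.∑ elements (λ x → ℕΣ.when (¬? (x ≟ 0#) ×-dec (s ≟ (x * x))) 1)
        ≡⟨ ℕΣ.∑-cong elements (λ x →
           ℕΣ.when-⇔ _ ((x ≟ y) ⊎-dec (x ≟ (- y))) (to x) (from x) 1) ⟩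
      ℕΣ.∑ elements (λ x → ℕΣ.when ((x ≟ y) ⊎-dec (x ≟ (- y))) 1)
        ≡⟨ ℕΣ.∑-cong elements (λ x →
            ℕΣ.when-⊎-dec (x ≟ y) (x ≟ (- y)) (λ (x≡y , x≡-y) → x≢0⇒x≢-x y≢0 (trans (sym x≡y) x≡-y)) 1) ⟩
      ℕΣ.∑ elements (λ x → ℕΣ.when (x ≟ y) 1 ℕ.+ ℕΣ.when (x ≟ (- y)) 1)
        ≡⟨ ℕΣ.∑-∙ elements _ _ ⟩
      ℕΣ.∑ elements (λ x → ℕΣ.when (x ≟ y) 1) ℕ.+ ℕΣ.∑ elements (λ x → ℕΣ.when (x ≟ (- y)) 1)
        ≡⟨ cong₂ ℕ._+_ (∑-when-≡ℕ y) (∑-when-≡ℕ (- y)) ⟩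
      2 ∎
      where
      open ≡-Reasoning
      open ℕΣ.Enumeration _≟_ elements unique complete using () renaming (∑-when-≡ to ℕΣ-when-≡)
      ∑-when-≡ℕ : ∀ z → ℕΣ.∑ elements (λ x → ℕΣ.when (x ≟ z) 1) ≡ 1
      ∑-when-≡ℕ = ℕΣ-when-≡ (λ _ → 1)
      -y≢0 : - y ≢ 0#
      -y≢0 -y≡0 = y≢0 (trans (sym (-‿involutive y)) (trans (cong -_ -y≡0) -0#≈0#))
      to : ∀ x → x ≢ 0# × s ≡ x * x → x ≡ y ⊎ x ≡ - y
      to x (_ , s≡x²) = x²≡y²⇒x≡±y x y (trans (sym s≡x²) (sym y²≡s))
      from : ∀ x → x ≡ y ⊎ x ≡ - y → x ≢ 0# × s ≡ x * x
      from x (inj₁ refl) = y≢0 , sym y²≡s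
      from x (inj₂ refl) = -y≢0 , trans (sym y²≡s) (sym (-y*-y≡y*y y))

    2|squares|≡|units| : 2 ℕ.* length squares ≡ length units
    2|squares|≡|units| = sym (begin
      length units
        ≡⟨ length≡ℕΣ units ⟩
      ℕΣ.∑ units (λ _ → 1)
        ≡⟨ ℕΣ.∑-filter (λ x → ¬? (x ≟ 0#)) elements _ ⟩
      ℕΣ.∑ elements (λ x → ℕΣ.when (¬? (x ≟ 0#)) 1)
        ≡⟨ ℕΣ.∑-cong elements (λ x → cong (ℕΣ.when (¬? (x ≟ 0#)))
              (sym (ℕΣ-when-≡ (λ _ → 1) (x * x)))) ⟩
      ℕΣ.∑ elements (λ x → ℕΣ.when (¬? (x ≟ 0#)) (ℕΣ.∑ elements (λ s → ℕΣ.when (s ≟ (x * x)) 1)))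
        ≡⟨ ℕΣ.∑-cong elements (λ x → ℕΣ.when-∑ (¬? (x ≟ 0#)) elements _) ⟩
      ℕΣ.∑ elements (λ x → ℕΣ.∑ elements (λ s → ℕΣ.when (¬? (x ≟ 0#)) (ℕΣ.when (s ≟ (x * x)) 1)))
        ≡⟨ ℕΣ.∑-swap elements elements _ ⟩
      ℕΣ.∑ elements (λ s → ℕΣ.∑ elements (λ x → ℕΣ.when (¬? (x ≟ 0#)) (ℕΣ.when (s ≟ (x * x)) 1)))
        ≡⟨ ℕΣ.∑-cong elements (λ s → trans (ℕΣ.∑-cong elements (λ x →
              ℕΣ.when-×-dec (¬? (x ≟ 0#)) (s ≟ (x * x)) 1)) (square-roots s)) ⟩
      ℕΣ.∑ elements (λ s → ℕΣ.when (square? s) 2)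
        ≡⟨ sym (ℕΣ.∑-filter square? elements _) ⟩
      ℕΣ.∑ squares (λ _ → 2)
        ≡⟨ ℕΣ-const squares 2 ⟩
      length squares ℕ.* 2
        ≡⟨ ℕₚ.*-comm (length squares) 2 ⟩
      2 ℕ.* length squares ∎)
      where
      open ≡-Reasoning
      open ℕΣ.Enumeration _≟_ elements unique complete using () renaming (∑-when-≡ to ℕΣ-when-≡)

    Square⇒x^|squares|≡1 : ∀ {x} → Square x → x ^ length squares ≡ 1#
    Square⇒x^|squares|≡1 (y , y≢0 , refl) = begin
      (y * y) ^ M          ≡⟨ *-^ y y M ⟩
      y ^ M * y ^ M        ≡⟨ sym (^-+ y M M) ⟩
      y ^ (M ℕ.+ M)        ≡⟨ cong (λ n → y ^ (M ℕ.+ n)) (sym (ℕₚ.+-identityʳ M)) ⟩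
      y ^ (2 ℕ.* M)        ≡⟨ cong (y ^_) 2|squares|≡|units| ⟩
      y ^ length units     ≡⟨ x^|units|≡1 y≢0 ⟩
      1#                   ∎
      where
      open ≡-Reasoning
      M = length squares

    euler-criterion : ∀ {x} → x ^ length squares ≡ 1# → Square x
    euler-criterion {x} x^M≡1 =
      proj₂ (∈-filter⁻ square? {xs = elements} (roots⊆squares (∈-filter⁺ root? (complete x) x^M≡1)))
      where
      M = length squares
      root? : ∀ r → Dec (r ^ M ≡ 1#)
      root? r = (r ^ M) ≟ 1#
      roots = filter root? elements
      squares⊆roots : squares ⊆ roots
      squares⊆roots s∈squares =
        ∈-filter⁺ root? (complete _) (Square⇒x^|squares|≡1 (proj₂ (∈-filter⁻ square? {xs = elements} s∈squares)))
      1∈squares : 1# ∈ squares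
      1∈squares = ∈-filter⁺ square? (complete 1#) (1# , 0≢1 ∘ sym , *-identityˡ 1#)
      instance
        M≢0 : ℕ.NonZero M
        M≢0 = ℕ.>-nonZero (∈-length 1∈squares)
      M≡1+[M-1] : M ≡ suc (ℕ.pred M)
      M≡1+[M-1] = sym (ℕₚ.suc-pred M)
      |roots|≤M : length roots ℕ.≤ M
      |roots|≤M = subst (length roots ℕ.≤_) (sym M≡1+[M-1])
        (roots-xⁿ⁺¹≡c (ℕ.pred M) 1# (Unique-filter⁺ root? unique)
          (λ {r} r∈roots → subst (λ n → r ^ n ≡ 1#) M≡1+[M-1] (proj₂ (∈-filter⁻ root? {xs = elements} r∈roots))))
      roots⊆squares : roots ⊆ squares
      roots⊆squares = UniqueList.pigeonhole _≟_ (Unique-filter⁺ square? unique) squares⊆roots |roots|≤M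


module QuadraticExtension (F : FiniteField) (q : ℕ) {p k : ℕ} (p-prime : Prime p) (q≡pᵏ⁺¹ : q ≡ p ℕ.^ suc k)
                (q-odd : q ℕ.% 2 ≡ 1) (order≡q² : FiniteField.order F ≡ q ℕ.* q) where

  open FiniteFieldTheory F public

  ι-q≡0 : ι q ≡ 0#
  ι-q≡0 = [ id , id ]′ (x*y≡0⇒x≡0⊎y≡0 (ι q) (ι q) ι-q*ι-q≡0)
    where
    ι-q*ι-q≡0 : ι q * ι q ≡ 0#
    ι-q*ι-q≡0 = trans (sym (ι-* q q)) (trans (cong ι (sym order≡q²)) ι-order≡0)

  ι-p≡0 : ι p ≡ 0#
  ι-p≡0 = ^≡0⇒≡0 (ι p) (suc k) (trans (sym (ι-^ p (suc k))) (trans (cong ι (sym q≡pᵏ⁺¹)) ι-q≡0))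

  t : ℕ
  t = q ℕ./ 2

  q≡1+2t : q ≡ suc (2 ℕ.* t)
  q≡1+2t = trans (m≡m%n+[m/n]*n q 2) (cong₂ ℕ._+_ q-odd (ℕₚ.*-comm t 2))

  ι2≢0 : ι 2 ≢ 0#
  ι2≢0 ι2≡0 = 0≢1 (begin
    0#                 ≡⟨ sym ι-q≡0 ⟩
    ι q                ≡⟨ trans (cong ι q≡1+2t) (cong (1# +_) (ι-* 2 t)) ⟩
    1# + ι 2 * ι t     ≡⟨ cong (λ z → 1# + z * ι t) ι2≡0 ⟩
    1# + 0# * ι t      ≡⟨ trans (cong (1# +_) (zeroˡ (ι t))) (+-identityʳ 1#) ⟩
    1#                 ∎)
    where open ≡-Reasoning

  q≢1 : q ≢ 1
  q≢1 q≡1 = 0≢1 (trans (sym ι-q≡0) (trans (cong ι q≡1) (+-identityʳ 1#)))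

  instance
    t≢0 : ℕ.NonZero t
    t≢0 = ℕ.≢-nonZero λ t≡0 → q≢1 (trans q≡1+2t (cong (λ n → suc (2 ℕ.* n)) t≡0))

    q≢0 : ℕ.NonZero q
    q≢0 = subst ℕ.NonZero (sym q≡1+2t) _

  open OddCharacteristic ι2≢0 public

  |squares|≡2t[t+1] : length squares ≡ 2 ℕ.* t ℕ.* suc t
  |squares|≡2t[t+1] = ℕₚ.*-cancelˡ-≡ (length squares) (2 ℕ.* t ℕ.* suc t) 2 (begin
    2 ℕ.* length squares
      ≡⟨ 2|squares|≡|units| ⟩
    length units
      ≡⟨ ℕₚ.suc-injective (trans 1+|units|≡order (trans order≡q² (cong (λ n → n ℕ.* n) q≡1+2t))) ⟩
    2 ℕ.* t ℕ.+ 2 ℕ.* t ℕ.* suc (2 ℕ.* t)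
      ≡⟨ NatSolver.solve 1 (λ t → con 2 :* t :+ con 2 :* t :* (con 1 :+ con 2 :* t)
                            := con 2 :* (con 2 :* t :* (con 1 :+ t))) refl t ⟩
    2 ℕ.* (2 ℕ.* t ℕ.* suc t) ∎)
    where
    open ≡-Reasoning
    open NatSolver using (_:+_; _:*_; _:=_; con)

  |squares|+2t*t≡2t*q : length squares ℕ.+ 2 ℕ.* t ℕ.* t ≡ 2 ℕ.* t ℕ.* q
  |squares|+2t*t≡2t*q = begin
    length squares ℕ.+ 2 ℕ.* t ℕ.* t
      ≡⟨ cong (ℕ._+ 2 ℕ.* t ℕ.* t) |squares|≡2t[t+1] ⟩
    2 ℕ.* t ℕ.* suc t ℕ.+ 2 ℕ.* t ℕ.* t
      ≡⟨ NatSolver.solve 1 (λ t → con 2 :* t :* (con 1 :+ t) :+ con 2 :* t :* t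
                         := con 2 :* t :* (con 1 :+ con 2 :* t)) refl t ⟩
    2 ℕ.* t ℕ.* suc (2 ℕ.* t)
      ≡⟨ cong (2 ℕ.* t ℕ.*_) (sym q≡1+2t) ⟩
    2 ℕ.* t ℕ.* q ∎
    where
    open ≡-Reasoning
    open NatSolver using (_:+_; _:*_; _:=_; con)

  |squares|≡t+t*q : length squares ≡ t ℕ.+ t ℕ.* q
  |squares|≡t+t*q = begin
    length squares
      ≡⟨ |squares|≡2t[t+1] ⟩
    2 ℕ.* t ℕ.* suc t
      ≡⟨ NatSolver.solve 1 (λ t → con 2 :* t :* (con 1 :+ t) := t :+ t :* (con 1 :+ con 2 :* t)) refl t ⟩
    t ℕ.+ t ℕ.* suc (2 ℕ.* t)
      ≡⟨ cong (λ n → t ℕ.+ t ℕ.* n) (sym q≡1+2t) ⟩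
    t ℕ.+ t ℕ.* q ∎
    where
    open ≡-Reasoning
    open NatSolver using (_:+_; _:*_; _:=_; con)

  φ : Carrier → Carrier
  φ x = x ^ q

  φ-+ : ∀ x y → φ (x + y) ≡ φ x + φ y
  φ-+ x y = subst (λ n → (x + y) ^ n ≡ x ^ n + y ^ n) (sym q≡pᵏ⁺¹) (Frobenius.^pⁿ-+ p-prime ι-p≡0 (suc k) x y)

  φ-* : ∀ x y → φ (x * y) ≡ φ x * φ y
  φ-* x y = *-^ x y q

  φ-0 : φ 0# ≡ 0#
  φ-0 = subst (λ n → 0# ^ n ≡ 0#) (sym q≡1+2t) (zeroˡ _)

  φ-1 : φ 1# ≡ 1#
  φ-1 = 1^ q

  φ-‿ : ∀ x → φ (- x) ≡ - φ x
  φ-‿ x = +-inverseˡ-unique (φ (- x)) (φ x) (trans (sym (φ-+ (- x) x)) (trans (cong φ (-‿inverseˡ x)) φ-0))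

  φ∘φ≡id : ∀ x → φ (φ x) ≡ x
  φ∘φ≡id x = trans (sym (^-* x q q)) (trans (cong (x ^_) (sym order≡q²)) (x^order≡x x))

  K : Carrier → Set
  K = InSubfield F q

  K? : ∀ x → Dec (K x)
  K? x = φ x ≟ x

  subfield : List Carrier
  subfield = filter K? elements

  K-0 : K 0#
  K-0 = φ-0

  K-+ : ∀ {x y} → K x → K y → K (x + y)
  K-+ {x} {y} Kx Ky = trans (φ-+ x y) (cong₂ _+_ Kx Ky)

  K-* : ∀ {x y} → K x → K y → K (x * y)
  K-* {x} {y} Kx Ky = trans (φ-* x y) (cong₂ _*_ Kx Ky)

  K-‿ : ∀ {x} → K x → K (- x)
  K-‿ {x} Kx = trans (φ-‿ x) (cong -_ Kx)

  K-inv : ∀ {x} (x≢0 : x ≢ 0#) → K x → K (inv x x≢0)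
  K-inv {x} x≢0 Kx = *-cancelˡ x x≢0 (begin
    x * φ (inv x x≢0)       ≡⟨ cong (_* φ (inv x x≢0)) (sym Kx) ⟩
    φ x * φ (inv x x≢0)     ≡⟨ sym (φ-* x _) ⟩
    φ (x * inv x x≢0)       ≡⟨ cong φ (inv-inverseʳ x≢0) ⟩
    φ 1#                    ≡⟨ φ-1 ⟩
    1#                      ≡⟨ sym (inv-inverseʳ x≢0) ⟩
    x * inv x x≢0           ∎)
    where open ≡-Reasoning

  K⇒∈subfield : ∀ {x} → K x → x ∈ subfield
  K⇒∈subfield Kx = ∈-filter⁺ K? (complete _) Kx

  ∈subfield⇒K : ∀ {x} → x ∈ subfield → K x
  ∈subfield⇒K x∈subfield = proj₂ (∈-filter⁻ K? {xs = elements} x∈subfield)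

  roots-x^q≡sx : ∀ s {rs} → Unique rs → (∀ {r} → r ∈ rs → r ^ q ≡ s * r) → length rs ℕ.≤ q
  roots-x^q≡sx s {rs} rs! roots =
    subst (length rs ℕ.≤_) (sym q≡2+n)
          (roots-xⁿ⁺²≡sx n s rs! (λ {r} r∈rs → subst (λ m → r ^ m ≡ s * r) q≡2+n (roots r∈rs)))
    where
    n = ℕ.pred (2 ℕ.* t)
    q≡2+n : q ≡ suc (suc n)
    q≡2+n = trans q≡1+2t (cong suc (sym (ℕₚ.suc-pred (2 ℕ.* t) {{ℕₚ.m*n≢0 2 t}})))

  |subfield|≤q : length subfield ℕ.≤ q
  |subfield|≤q = roots-x^q≡sx 1# (Unique-filter⁺ K? unique)
                               (λ r∈subfield → trans (∈subfield⇒K r∈subfield) (sym (*-identityˡ _)))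

  K[x+φx] : ∀ x → K (x + φ x)
  K[x+φx] x = trans (φ-+ x (φ x)) (trans (cong (φ x +_) (φ∘φ≡id x)) (+-comm (φ x) x))

  φ[x-φx]≡-[x-φx] : ∀ x → φ (x - φ x) ≡ - (x - φ x)
  φ[x-φx]≡-[x-φx] x = begin
    φ (x + - φ x)        ≡⟨ φ-+ x (- φ x) ⟩
    φ x + φ (- φ x)      ≡⟨ cong (φ x +_) (trans (φ-‿ (φ x)) (cong -_ (φ∘φ≡id x))) ⟩
    φ x + - x            ≡⟨ +-comm (φ x) (- x) ⟩
    - x + φ x            ≡⟨ cong (- x +_) (sym (-‿involutive (φ x))) ⟩
    - x + - - φ x        ≡⟨ -‿+-comm x (- φ x) ⟩
    - (x + - φ x)        ∎
    where open ≡-Reasoning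

  split : Carrier → Carrier × Carrier
  split x = x + φ x , x - φ x

  split-injective : ∀ {x y} → split x ≡ split y → x ≡ y
  split-injective {x} {y} split≡ = x+x≡y+y⇒x≡y (begin
    x + x                            ≡⟨ sym (sum-split x) ⟩
    (x + φ x) + (x - φ x)            ≡⟨ cong₂ _+_ (cong proj₁ split≡) (cong proj₂ split≡) ⟩
    (y + φ y) + (y - φ y)            ≡⟨ sum-split y ⟩
    y + y                            ∎)
    where
    open ≡-Reasoning
    open import Algebra.Properties.CommutativeSemigroup +-commutativeSemigroup using (interchange)
    sum-split : ∀ x → (x + φ x) + (x - φ x) ≡ x + x
    sum-split x = trans (interchange x (φ x) x (- φ x))
                        (trans (cong (x + x +_) (-‿inverseʳ (φ x))) (+-identityʳ (x + x)))

  -- split injects F into K × {y | φ y ≡ - y}, and both factors have at most q elements, being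
  -- roots of x ^ q ≡ ± x.
  q≤|subfield| : q ℕ.≤ length subfield
  q≤|subfield| = ℕₚ.*-cancelʳ-≤ q (length subfield) q (begin
    q ℕ.* q
      ≡⟨ sym order≡q² ⟩
    length elements
      ≡⟨ sym (length-map split elements) ⟩
    length (map split elements)
      ≤⟨ UniqueList.Unique⇒length≤ (Unique-map⁺ split-injective unique) split∈ ⟩
    length (cartesianProduct subfield antisubfield)
      ≡⟨ UniqueList.length-cartesianProduct subfield antisubfield ⟩
    length subfield ℕ.* length antisubfield
      ≤⟨ ℕₚ.*-monoʳ-≤ (length subfield) |antisubfield|≤q ⟩
    length subfield ℕ.* q ∎)
    where
    open ℕₚ.≤-Reasoning
    anti? : ∀ x → Dec (φ x ≡ - x)
    anti? x = φ x ≟ (- x)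
    antisubfield = filter anti? elements
    |antisubfield|≤q : length antisubfield ℕ.≤ q
    |antisubfield|≤q = roots-x^q≡sx (- 1#) (Unique-filter⁺ anti? unique)
      (λ r∈anti → trans (proj₂ (∈-filter⁻ anti? {xs = elements} r∈anti)) (sym (-1*x≈-x _)))
    split∈ : map split elements ⊆ cartesianProduct subfield antisubfield
    split∈ m with ∈-map⁻ split m
    ... | x , _ , refl =
      ∈-cartesianProduct⁺ (K⇒∈subfield (K[x+φx] x)) (∈-filter⁺ anti? (complete _) (φ[x-φx]≡-[x-φx] x))

  |subfield|≡q : length subfield ≡ q
  |subfield|≡q = ℕₚ.≤-antisym |subfield|≤q q≤|subfield|

  K-− : ∀ {x y} → K x → K y → K (x - y)
  K-− Kx Ky = K-+ Kx (K-‿ Ky)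

  K*⇒Square : ∀ {c} → K c → c ≢ 0# → Square c
  K*⇒Square {c} Kc c≢0 = euler-criterion (begin
    c ^ length squares          ≡⟨ cong (c ^_) |squares|≡2t[t+1] ⟩
    c ^ (2 ℕ.* t ℕ.* suc t)     ≡⟨ ^-* c (2 ℕ.* t) (suc t) ⟩
    (c ^ (2 ℕ.* t)) ^ suc t     ≡⟨ cong (_^ suc t) c^2t≡1 ⟩
    1# ^ suc t                  ≡⟨ 1^ (suc t) ⟩
    1#                          ∎)
    where
    open ≡-Reasoning
    c^2t≡1 : c ^ (2 ℕ.* t) ≡ 1#
    c^2t≡1 = *-cancelˡ c c≢0 (trans (subst (λ n → c ^ n ≡ c) q≡1+2t Kc) (sym (*-identityʳ c)))

  module Basis {s b : Carrier} (b≢0 : b ≢ 0#) (s∉Kb : ¬ ∃ λ d → K d × s ≡ d * b) where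

    open SemiringSolver using (solve; _:+_; _:*_; _:=_)

    independent : ∀ {c e} → K c → K e → c * s + e * b ≡ 0# → c ≡ 0# × e ≡ 0#
    independent {c} {e} Kc Ke cs+eb≡0 with c ≟ 0#
    ... | yes refl = refl , [ id , (λ b≡0 → contradiction b≡0 b≢0) ]′ (x*y≡0⇒x≡0⊎y≡0 e b eb≡0)
      where
      eb≡0 : e * b ≡ 0#
      eb≡0 = trans (sym (+-identityˡ (e * b))) (trans (cong (_+ e * b) (sym (zeroˡ s))) cs+eb≡0)
    ... | no  c≢0  = contradiction (- (c⁻¹ * e) , K-‿ (K-* (K-inv c≢0 Kc) Ke) , s≡) s∉Kb
      where
      open ≡-Reasoning
      c⁻¹ = inv c c≢0
      s≡ : s ≡ - (c⁻¹ * e) * b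
      s≡ = begin
        s                      ≡⟨ sym (inv-cancelˡ c≢0 s) ⟩
        c⁻¹ * (c * s)          ≡⟨ cong (c⁻¹ *_) (+-inverseˡ-unique (c * s) (e * b) cs+eb≡0) ⟩
        c⁻¹ * - (e * b)        ≡⟨ sym (-‿distribʳ-* c⁻¹ (e * b)) ⟩
        - (c⁻¹ * (e * b))      ≡⟨ cong -_ (sym (*-assoc c⁻¹ e b)) ⟩
        - (c⁻¹ * e * b)        ≡⟨ -‿distribˡ-* (c⁻¹ * e) b ⟩
        - (c⁻¹ * e) * b        ∎

    coordinates-unique : ∀ {c e c′ e′} → K c → K e → K c′ → K e′ →
                         c * s + e * b ≡ c′ * s + e′ * b → c ≡ c′ × e ≡ e′
    coordinates-unique {c} {e} {c′} {e′} Kc Ke Kc′ Ke′ same with independent (K-− Kc Kc′) (K-− Ke Ke′) difference≡0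
      where
      open ≡-Reasoning
      X = c′ * s + e′ * b
      difference≡0 : (c - c′) * s + (e - e′) * b ≡ 0#
      difference≡0 = +-cancelʳ X _ _ (begin
        (c - c′) * s + (e - e′) * b + X
          ≡⟨ solve 6 (λ d₁ d₂ c′ e′ s b → d₁ :* s :+ d₂ :* b :+ (c′ :* s :+ e′ :* b)
                      := (d₁ :+ c′) :* s :+ (d₂ :+ e′) :* b) refl (c - c′) (e - e′) c′ e′ s b ⟩
        ((c - c′) + c′) * s + ((e - e′) + e′) * b
          ≡⟨ cong₂ (λ x y → x * s + y * b) (//-rightDividesˡ c′ c) (//-rightDividesˡ e′ e) ⟩
        c * s + e * b
          ≡⟨ same ⟩
        X
          ≡⟨ sym (+-identityˡ X) ⟩
        0# + X ∎)
    ... | c-c′≡0 , e-e′≡0 = x∙y⁻¹≈ε⇒x≈y c c′ c-c′≡0 , x∙y⁻¹≈ε⇒x≈y e e′ e-e′≡0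

    combine : Carrier × Carrier → Carrier
    combine (c , e) = c * s + e * b

    pairs : List (Carrier × Carrier)
    pairs = cartesianProduct subfield subfield

    pairs⇒K : ∀ {ce} → ce ∈ pairs → K (proj₁ ce) × K (proj₂ ce)
    pairs⇒K {ce} ce∈pairs with ∈-cartesianProduct⁻ subfield subfield {ce} ce∈pairs
    ... | c∈subfield , e∈subfield = ∈subfield⇒K c∈subfield , ∈subfield⇒K e∈subfield

    combinations! : Unique (map combine pairs)
    combinations! = UniqueList.Unique-map⁺-injectiveOn combine
      (Unique-cartesianProduct⁺ (Unique-filter⁺ K? unique) (Unique-filter⁺ K? unique)) injective
      where
      injective : ∀ {x y} → x ∈ pairs → y ∈ pairs → combine x ≡ combine y → x ≡ y
      injective x∈pairs y∈pairs same with pairs⇒K x∈pairs | pairs⇒K y∈pairs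
      ... | Kc , Ke | Kc′ , Ke′ with coordinates-unique Kc Ke Kc′ Ke′ same
      ...   | refl , refl = refl

    |combinations|≡order : length (map combine pairs) ≡ length elements
    |combinations|≡order = begin
      length (map combine pairs)               ≡⟨ length-map combine pairs ⟩
      length pairs                             ≡⟨ UniqueList.length-cartesianProduct subfield subfield ⟩
      length subfield ℕ.* length subfield      ≡⟨ cong₂ ℕ._*_ |subfield|≡q |subfield|≡q ⟩
      q ℕ.* q                                  ≡⟨ sym order≡q² ⟩
      length elements                          ∎
      where open ≡-Reasoning

    coordinates : ∀ w → ∃ λ c → ∃ λ e → K c × K e × w ≡ c * s + e * b
    coordinates w with ∈-map⁻ combine (UniqueList.pigeonhole _≟_ combinations! (λ _ → complete _)
                                         (ℕₚ.≤-reflexive (sym |combinations|≡order)) (complete w))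
    ... | (c , e) , ce∈pairs , w≡ = c , e , proj₁ (pairs⇒K ce∈pairs) , proj₂ (pairs⇒K ce∈pairs) , w≡


module Rational where

  open import Data.Integer using (+_)
  open import Data.Integer.GCD using (gcd)
  import Data.Integer.Properties as ℤₚ
  import Data.Rational.Unnormalised as ℚᵘ
  import Data.Rational.Unnormalised.Properties as ℚᵘₚ

  private
    module RationalSum = RingSum ℚₚ.+-*-isCommutativeRing
  open RationalSum public hiding (ι; ι-+; ι-*; ∑-const)
  open import Algebra.Properties.Ring ℚₚ.+-*-ring public using (+-cancelˡ; //-rightDividesʳ)

  sumℚ≡∑ : ∀ {X : Set} (f : X → ℚ) xs → sumℚ (map f xs) ≡ ∑ xs f
  sumℚ≡∑ f []       = refl
  sumℚ≡∑ f (x ∷ xs) = cong (f x ℚ.+_) (sumℚ≡∑ f xs)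

  ℕtoℚ-suc : ∀ n → ℕtoℚ (suc n) ≡ 1ℚ ℚ.+ ℕtoℚ n
  ℕtoℚ-suc n = ℚₚ.toℚᵘ-injective (begin
    ℚ.toℚᵘ (ℕtoℚ (suc n))
      ≈⟨ ℚₚ.toℚᵘ-fromℚᵘ (ℚᵘ.mkℚᵘ (+ suc n) 0) ⟩
    ℚᵘ.mkℚᵘ (+ suc n) 0
      ≈⟨ ℚᵘ.*≡* (cong (ℤ._* + 1) (sym (cong₂ ℤ._+_ (ℤₚ.*-identityʳ (+ 1)) (ℤₚ.*-identityʳ (+ n))))) ⟩
    ℚ.toℚᵘ 1ℚ ℚᵘ.+ ℚᵘ.mkℚᵘ (+ n) 0
      ≈⟨ ℚᵘₚ.+-congʳ (ℚ.toℚᵘ 1ℚ) (ℚᵘₚ.≃-sym (ℚₚ.toℚᵘ-fromℚᵘ (ℚᵘ.mkℚᵘ (+ n) 0))) ⟩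
    ℚ.toℚᵘ 1ℚ ℚᵘ.+ ℚ.toℚᵘ (ℕtoℚ n)
      ≈⟨ ℚᵘₚ.≃-sym (ℚₚ.toℚᵘ-homo-+ 1ℚ (ℕtoℚ n)) ⟩
    ℚ.toℚᵘ (1ℚ ℚ.+ ℕtoℚ n) ∎)
    where open ℚᵘₚ.≃-Reasoning

  ℕtoℚ≡ι : ∀ n → ℕtoℚ n ≡ RationalSum.ι n
  ℕtoℚ≡ι zero    = refl
  ℕtoℚ≡ι (suc n) = trans (ℕtoℚ-suc n) (cong (1ℚ ℚ.+_) (ℕtoℚ≡ι n))

  ℕtoℚ-+ : ∀ m n → ℕtoℚ (m ℕ.+ n) ≡ ℕtoℚ m ℚ.+ ℕtoℚ n
  ℕtoℚ-+ m n = trans (ℕtoℚ≡ι (m ℕ.+ n)) (trans (RationalSum.ι-+ m n) (sym (cong₂ ℚ._+_ (ℕtoℚ≡ι m) (ℕtoℚ≡ι n))))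

  ℕtoℚ-* : ∀ m n → ℕtoℚ (m ℕ.* n) ≡ ℕtoℚ m ℚ.* ℕtoℚ n
  ℕtoℚ-* m n = trans (ℕtoℚ≡ι (m ℕ.* n)) (trans (RationalSum.ι-* m n) (sym (cong₂ ℚ._*_ (ℕtoℚ≡ι m) (ℕtoℚ≡ι n))))

  ∑-const : ∀ {X : Set} (xs : List X) c → ∑[ x ∈ xs ] c ≡ ℕtoℚ (length xs) ℚ.* c
  ∑-const xs c = trans (RationalSum.∑-const xs c) (cong (ℚ._* c) (sym (ℕtoℚ≡ι (length xs))))

  -- The numerator of n / 1 times gcd n 1 is n.
  ℕtoℚ≢0 : ∀ n .{{_ : ℕ.NonZero n}} → ℕtoℚ n ≢ 0ℚ
  ℕtoℚ≢0 (suc n) n+1≡0 with trans (sym (ℚₚ.↥-/ (+ suc n) 1)) (cong (λ r → ↥ r ℤ.* gcd (+ suc n) (+ 1)) n+1≡0)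
  ... | ()

  *-cancelˡ : ∀ x {y z} → x ≢ 0ℚ → x ℚ.* y ≡ x ℚ.* z → y ≡ z
  *-cancelˡ x {y} {z} x≢0 xy≡xz = begin
    y                         ≡⟨ sym (ℚₚ.*-identityˡ y) ⟩
    1ℚ ℚ.* y                  ≡⟨ cong (ℚ._* y) (sym (ℚₚ.*-inverseˡ x)) ⟩
    ℚ.1/ x ℚ.* x ℚ.* y        ≡⟨ ℚₚ.*-assoc (ℚ.1/ x) x y ⟩
    ℚ.1/ x ℚ.* (x ℚ.* y)      ≡⟨ cong (ℚ.1/ x ℚ.*_) xy≡xz ⟩
    ℚ.1/ x ℚ.* (x ℚ.* z)      ≡⟨ sym (ℚₚ.*-assoc (ℚ.1/ x) x z) ⟩
    ℚ.1/ x ℚ.* x ℚ.* z        ≡⟨ cong (ℚ._* z) (ℚₚ.*-inverseˡ x) ⟩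
    1ℚ ℚ.* z                  ≡⟨ ℚₚ.*-identityˡ z ⟩
    z                         ∎
    where
    open ≡-Reasoning
    instance _ = ℚ.≢-nonZero x≢0

module PaleyEigenspace (F : FiniteField) (q : ℕ) {p k : ℕ} (p-prime : Prime p) (q≡pᵏ⁺¹ : q ≡ p ℕ.^ suc k)
                       (q-odd : q ℕ.% 2 ≡ 1) (order≡q² : FiniteField.order F ≡ q ℕ.* q) where

  open QuadraticExtension F q {p} {k} p-prime q≡pᵏ⁺¹ q-odd order≡q²
  open Rational hiding (+-cancelˡ; //-rightDividesʳ; *-cancelˡ)
  open Enumeration _≟_ elements unique complete

  adj : (Carrier → ℚ) → Carrier → ℚ
  adj f γ = ∑[ s ∈ elements ] when (square? s) (f (γ - s))

  sum-neighbours≡adj : ∀ f γ → sumℚ (map f (filter (paleyAdj? F γ) elements)) ≡ adj f γ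
  sum-neighbours≡adj f γ = begin
    sumℚ (map f (filter (paleyAdj? F γ) elements))
      ≡⟨ sumℚ≡∑ f (filter (paleyAdj? F γ) elements) ⟩
    ∑ (filter (paleyAdj? F γ) elements) f
      ≡⟨ ∑-filter (paleyAdj? F γ) elements f ⟩
    ∑[ δ ∈ elements ] when (paleyAdj? F γ δ) (f δ)
      ≡⟨ ∑-cong elements (λ δ → when-⇔ (paleyAdj? F γ δ) (square? (γ - δ))
           proj₂ (λ □γ-δ → γ≢δ □γ-δ , □γ-δ) (f δ)) ⟩
    ∑[ δ ∈ elements ] when (square? (γ - δ)) (f δ)
      ≡⟨ sym (∑-bijection (λ x → γ - x) (λ x → γ - x) (x-[x-y]≡y γ) (x-[x-y]≡y γ) _) ⟩
    ∑[ s ∈ elements ] when (square? (γ - (γ - s))) (f (γ - s))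
      ≡⟨ ∑-cong elements (λ s → cong (λ z → when (square? z) (f (γ - s))) (x-[x-y]≡y γ s)) ⟩
    adj f γ ∎
    where
    open ≡-Reasoning
    γ≢δ : ∀ {δ} → Square (γ - δ) → γ ≢ δ
    γ≢δ □γ-δ refl = Square⇒≢0 □γ-δ (-‿inverseʳ γ)

  indicator : Carrier → Carrier → Carrier → ℚ
  indicator a b γ = when (onLine? F q a b γ) 1ℚ

  gLine≡q*indicator-1 : ∀ a b γ → gLine F q a b γ ≡ ℕtoℚ q ℚ.* indicator a b γ ℚ.- 1ℚ
  gLine≡q*indicator-1 a b γ with onLine? F q a b γ
  ... | yes _ = cong (ℚ._- 1ℚ) (sym (ℚₚ.*-identityʳ (ℕtoℚ q)))
  ... | no  _ = sym (trans (cong (ℚ._- 1ℚ) (ℚₚ.*-zeroʳ (ℕtoℚ q))) (ℚₚ.+-identityˡ _))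

  lineSum : Carrier → (Carrier → ℚ) → Carrier → ℚ
  lineSum s f γ = ∑[ c ∈ elements ] when (K? c) (f (γ - (c * s)))

  ∑-f*indicator≡lineSum : ∀ {b} → b ≢ 0# → ∀ f γ → ∑[ a ∈ elements ] (f a ℚ.* indicator a b γ) ≡ lineSum b f γ
  ∑-f*indicator≡lineSum {b} b≢0 f γ = begin
    ∑[ a ∈ elements ] (f a ℚ.* indicator a b γ)
      ≡⟨ ∑-cong elements (λ a → cong (f a ℚ.*_)
           (when-∃≡∑ (on a) (onLine? F q a b γ) (at-most-one a) 1ℚ)) ⟩
    ∑[ a ∈ elements ] (f a ℚ.* ∑[ c ∈ elements ] when (on a c) 1ℚ)
      ≡⟨ ∑-cong elements (λ a → ∑-distribˡ elements (f a) _) ⟩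
    ∑[ a ∈ elements ] ∑[ c ∈ elements ] (f a ℚ.* when (on a c) 1ℚ)
      ≡⟨ ∑-cong elements (λ a → ∑-cong elements (λ c →
           trans (sym (when-distribˡ (on a c) (f a) 1ℚ))
                 (cong (when (on a c)) (ℚₚ.*-identityʳ (f a))))) ⟩
    ∑[ a ∈ elements ] ∑[ c ∈ elements ] when (on a c) (f a)
      ≡⟨ ∑-swap elements elements _ ⟩
    ∑[ c ∈ elements ] ∑[ a ∈ elements ] when (on a c) (f a)
      ≡⟨ ∑-cong elements (λ c → ∑-cong elements (λ a →
           trans (when-⇔ (on a c) (K? c ×-dec (a ≟ (γ - (c * b))))
                   (map₂ (x≈z//y a (c * b) γ ∘ sym))
                   (map₂ (λ a≡ → sym (trans (cong (_+ c * b) a≡) (//-rightDividesˡ (c * b) γ))))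
                   (f a))
                 (sym (when-×-dec (K? c) (a ≟ (γ - (c * b))) (f a))))) ⟩
    ∑[ c ∈ elements ] ∑[ a ∈ elements ] when (K? c) (when (a ≟ (γ - (c * b))) (f a))
      ≡⟨ ∑-cong elements (λ c → sym (when-∑ (K? c) elements _)) ⟩
    ∑[ c ∈ elements ] when (K? c) (∑[ a ∈ elements ] when (a ≟ (γ - (c * b))) (f a))
      ≡⟨ ∑-cong elements (λ c → cong (when (K? c)) (∑-when-≡ f (γ - (c * b)))) ⟩
    lineSum b f γ ∎
    where
    open ≡-Reasoning
    on : ∀ a c → Dec (K c × γ ≡ a + c * b)
    on a c = K? c ×-dec (γ ≟ (a + c * b))
    at-most-one : ∀ a c c′ → K c × γ ≡ a + c * b → K c′ × γ ≡ a + c′ * b → c ≡ c′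
    at-most-one a c c′ (_ , γ≡) (_ , γ≡′) = *-cancelʳ b b≢0 (+-cancelˡ a (c * b) (c′ * b) (trans (sym γ≡) γ≡′))

  K*? : ∀ c → Dec (K c × c ≢ 0#)
  K*? c = K? c ×-dec ¬? (c ≟ 0#)

  ∑-when-K : ∀ h → ∑[ c ∈ elements ] when (K? c) (h c) ≡ h 0# ℚ.+ ∑[ c ∈ elements ] when (K*? c) (h c)
  ∑-when-K h = begin
    ∑[ c ∈ elements ] when (K? c) (h c)
      ≡⟨ ∑-cong elements (λ c → when-split (K? c) (c ≟ 0#) (h c)) ⟩
    ∑[ c ∈ elements ] (when (K? c ×-dec (c ≟ 0#)) (h c) ℚ.+ when (K*? c) (h c))
      ≡⟨ ∑-∙ elements _ _ ⟩
    ∑[ c ∈ elements ] when (K? c ×-dec (c ≟ 0#)) (h c) ℚ.+ ∑[ c ∈ elements ] when (K*? c) (h c)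
      ≡⟨ cong (ℚ._+ ∑[ c ∈ elements ] when (K*? c) (h c)) (∑-when-unique (λ c → K? c ×-dec (c ≟ 0#)) h
           unique (complete 0#) (K-0 , refl) (λ _ → proj₂)) ⟩
    h 0# ℚ.+ ∑[ c ∈ elements ] when (K*? c) (h c) ∎
    where open ≡-Reasoning

  ∑-when-K-const : ∀ x → ∑[ c ∈ elements ] when (K? c) x ≡ ℕtoℚ q ℚ.* x
  ∑-when-K-const x = trans (sym (∑-filter K? elements (λ _ → x)))
                           (trans (∑-const subfield x) (cong (λ n → ℕtoℚ n ℚ.* x) |subfield|≡q))

  ∑-when-K*-const : ∀ x → ∑[ c ∈ elements ] when (K*? c) x ≡ ℕtoℚ (2 ℕ.* t) ℚ.* x
  ∑-when-K*-const x = Rational.+-cancelˡ x _ _ (begin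
    x ℚ.+ ∑[ c ∈ elements ] when (K*? c) x     ≡⟨ sym (∑-when-K (λ _ → x)) ⟩
    ∑[ c ∈ elements ] when (K? c) x            ≡⟨ ∑-when-K-const x ⟩
    ℕtoℚ q ℚ.* x                               ≡⟨ cong (ℚ._* x) (trans (cong ℕtoℚ q≡1+2t) (ℕtoℚ-suc (2 ℕ.* t))) ⟩
    (1ℚ ℚ.+ ℕtoℚ (2 ℕ.* t)) ℚ.* x              ≡⟨ ℚₚ.*-distribʳ-+ x 1ℚ (ℕtoℚ (2 ℕ.* t)) ⟩
    1ℚ ℚ.* x ℚ.+ ℕtoℚ (2 ℕ.* t) ℚ.* x          ≡⟨ cong (ℚ._+ ℕtoℚ (2 ℕ.* t) ℚ.* x) (ℚₚ.*-identityˡ x) ⟩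
    x ℚ.+ ℕtoℚ (2 ℕ.* t) ℚ.* x                 ∎)
    where open ≡-Reasoning

  ∑-when-square-const : ∀ x → ∑[ s ∈ elements ] when (square? s) x ≡ ℕtoℚ (length squares) ℚ.* x
  ∑-when-square-const x = trans (sym (∑-filter square? elements _)) (∑-const squares x)

  lineSum-split : ∀ s f γ → lineSum s f γ ≡ f γ ℚ.+ ∑[ c ∈ elements ] when (K*? c) (f (γ - (c * s)))
  lineSum-split s f γ =
    trans (∑-when-K (λ c → f (γ - (c * s))))
          (cong (λ z → f z ℚ.+ ∑[ c ∈ elements ] when (K*? c) (f (γ - (c * s)))) γ-0s≡γ)
    where
    γ-0s≡γ : γ - (0# * s) ≡ γ
    γ-0s≡γ = trans (cong (λ z → γ + - z) (zeroˡ s)) (trans (cong (γ +_) -0#≈0#) (+-identityʳ γ))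

  adj-dilation : ∀ f γ {c} → K c × c ≢ 0# → ∑[ s ∈ elements ] when (square? s) (f (γ - (c * s))) ≡ adj f γ
  adj-dilation f γ {c} (Kc , c≢0) = trans
    (∑-cong elements (λ s → when-⇔ (square? s) (square? (c * s)) (Square-* □c) □s⇐□cs _))
    (∑-bijection (c *_) (inv c c≢0 *_) (inv-cancelˡ c≢0) (inv-cancelʳ c≢0) (λ s → when (square? s) (f (γ - s))))
    where
    □c : Square c
    □c = K*⇒Square Kc c≢0
    □s⇐□cs : ∀ {s} → Square (c * s) → Square s
    □s⇐□cs {s} □cs = subst Square (inv-cancelˡ c≢0 s) (Square-* (K*⇒Square (K-inv c≢0 Kc) (inv≢0 c≢0)) □cs)

  ∑-lineSums : ∀ f γ → ∑[ s ∈ elements ] when (square? s) (lineSum s f γ)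
                       ≡ ℕtoℚ (length squares) ℚ.* f γ ℚ.+ ℕtoℚ (2 ℕ.* t) ℚ.* adj f γ
  ∑-lineSums f γ = begin
    ∑[ s ∈ elements ] when (square? s) (lineSum s f γ)
      ≡⟨ ∑-cong elements (λ s →
          trans (cong (when (square? s)) (lineSum-split s f γ)) (when-∙ (square? s) _ _)) ⟩
    ∑[ s ∈ elements ] (when (square? s) (f γ) ℚ.+ when (square? s) (T s))
      ≡⟨ ∑-∙ elements _ _ ⟩
    ∑[ s ∈ elements ] when (square? s) (f γ) ℚ.+ ∑[ s ∈ elements ] when (square? s) (T s)
      ≡⟨ cong₂ ℚ._+_ (∑-when-square-const (f γ)) ∑∑≡ ⟩
    ℕtoℚ (length squares) ℚ.* f γ ℚ.+ ℕtoℚ (2 ℕ.* t) ℚ.* adj f γ ∎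
    where
    open ≡-Reasoning
    T : Carrier → ℚ
    T s = ∑[ c ∈ elements ] when (K*? c) (f (γ - (c * s)))
    ∑∑≡ : ∑[ s ∈ elements ] when (square? s) (T s) ≡ ℕtoℚ (2 ℕ.* t) ℚ.* adj f γ
    ∑∑≡ = begin
      ∑[ s ∈ elements ] when (square? s) (T s)
        ≡⟨ ∑-cong elements (λ s → when-∑ (square? s) elements _) ⟩
      ∑[ s ∈ elements ] ∑[ c ∈ elements ] when (square? s) (when (K*? c) (f (γ - (c * s))))
        ≡⟨ ∑-swap elements elements _ ⟩
      ∑[ c ∈ elements ] ∑[ s ∈ elements ] when (square? s) (when (K*? c) (f (γ - (c * s))))
        ≡⟨ ∑-cong elements (λ c →
           trans (∑-cong elements (λ s → when-comm (square? s) (K*? c) _))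
                 (sym (when-∑ (K*? c) elements _))) ⟩
      ∑[ c ∈ elements ] when (K*? c) (∑[ s ∈ elements ] when (square? s) (f (γ - (c * s))))
        ≡⟨ ∑-cong elements (λ c → when-cong (K*? c) (adj-dilation f γ)) ⟩
      ∑[ c ∈ elements ] when (K*? c) (adj f γ)
        ≡⟨ ∑-when-K*-const (adj f γ) ⟩
      ℕtoℚ (2 ℕ.* t) ℚ.* adj f γ ∎

  2t≢0 : ℕtoℚ (2 ℕ.* t) ≢ 0ℚ
  2t≢0 = ℕtoℚ≢0 (2 ℕ.* t) {{ℕₚ.m*n≢0 2 t}}

  M*x+2t*[t*x]≡2t*[q*x] : ∀ x → ℕtoℚ (length squares) ℚ.* x ℚ.+ ℕtoℚ (2 ℕ.* t) ℚ.* (ℕtoℚ t ℚ.* x)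
                                 ≡ ℕtoℚ (2 ℕ.* t) ℚ.* (ℕtoℚ q ℚ.* x)
  M*x+2t*[t*x]≡2t*[q*x] x = begin
    ℕtoℚ M ℚ.* x ℚ.+ ℕtoℚ (2 ℕ.* t) ℚ.* (ℕtoℚ t ℚ.* x)
      ≡⟨ cong (ℕtoℚ M ℚ.* x ℚ.+_) (sym (ℚₚ.*-assoc (ℕtoℚ (2 ℕ.* t)) (ℕtoℚ t) x)) ⟩
    ℕtoℚ M ℚ.* x ℚ.+ ℕtoℚ (2 ℕ.* t) ℚ.* ℕtoℚ t ℚ.* x
      ≡⟨ sym (ℚₚ.*-distribʳ-+ x (ℕtoℚ M) (ℕtoℚ (2 ℕ.* t) ℚ.* ℕtoℚ t)) ⟩
    (ℕtoℚ M ℚ.+ ℕtoℚ (2 ℕ.* t) ℚ.* ℕtoℚ t) ℚ.* x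
      ≡⟨ cong (ℚ._* x) (sym (trans (ℕtoℚ-+ M (2 ℕ.* t ℕ.* t))
                              (cong (ℕtoℚ M ℚ.+_) (ℕtoℚ-* (2 ℕ.* t) t)))) ⟩
    ℕtoℚ (M ℕ.+ 2 ℕ.* t ℕ.* t) ℚ.* x
      ≡⟨ cong (λ n → ℕtoℚ n ℚ.* x) |squares|+2t*t≡2t*q ⟩
    ℕtoℚ (2 ℕ.* t ℕ.* q) ℚ.* x
      ≡⟨ cong (ℚ._* x) (ℕtoℚ-* (2 ℕ.* t) q) ⟩
    ℕtoℚ (2 ℕ.* t) ℚ.* ℕtoℚ q ℚ.* x
      ≡⟨ ℚₚ.*-assoc (ℕtoℚ (2 ℕ.* t)) (ℕtoℚ q) x ⟩
    ℕtoℚ (2 ℕ.* t) ℚ.* (ℕtoℚ q ℚ.* x) ∎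
    where
    open ≡-Reasoning
    M = length squares

  eigenvalue-from-∑-lineSums : ∀ {A x} →
    ℕtoℚ (length squares) ℚ.* x ℚ.+ ℕtoℚ (2 ℕ.* t) ℚ.* A ≡ ℕtoℚ (2 ℕ.* t) ℚ.* (ℕtoℚ q ℚ.* x) → A ≡ ℕtoℚ t ℚ.* x
  eigenvalue-from-∑-lineSums {A} {x} M*x+2t*A≡2t*[q*x] = Rational.*-cancelˡ (ℕtoℚ (2 ℕ.* t)) 2t≢0
    (Rational.+-cancelˡ (ℕtoℚ (length squares) ℚ.* x) (ℕtoℚ (2 ℕ.* t) ℚ.* A) (ℕtoℚ (2 ℕ.* t) ℚ.* (ℕtoℚ t ℚ.* x))
      (trans M*x+2t*A≡2t*[q*x] (sym (M*x+2t*[t*x]≡2t*[q*x] x))))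

  module QuadraticLine {a b : Carrier} (□b : Square b) where

    g : Carrier → ℚ
    g = gLine F q a b

    b≢0 : b ≢ 0#
    b≢0 = Square⇒≢0 □b

    S : Carrier → Set
    S = OnLine F q a b

    g-cong : ∀ {x y} → (S x → S y) → (S y → S x) → g x ≡ g y
    g-cong {x} {y} x⇒y y⇒x = begin
      g x
        ≡⟨ gLine≡q*indicator-1 a b x ⟩
      ℕtoℚ q ℚ.* indicator a b x ℚ.- 1ℚ
        ≡⟨ cong (λ z → ℕtoℚ q ℚ.* z ℚ.- 1ℚ) (when-⇔ (onLine? F q a b x) (onLine? F q a b y) x⇒y y⇒x 1ℚ) ⟩
      ℕtoℚ q ℚ.* indicator a b y ℚ.- 1ℚ
        ≡⟨ sym (gLine≡q*indicator-1 a b y) ⟩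
      g y ∎
      where open ≡-Reasoning

    S-translate : ∀ {γ d} → K d → S γ → S (γ + d * b)
    S-translate {γ} {d} Kd (e , Ke , γ≡a+eb) =
      e + d , K-+ Ke Kd , (begin
        γ + d * b               ≡⟨ cong (_+ d * b) γ≡a+eb ⟩
        a + e * b + d * b       ≡⟨ +-assoc a (e * b) (d * b) ⟩
        a + (e * b + d * b)     ≡⟨ cong (a +_) (sym (distribʳ b e d)) ⟩
        a + (e + d) * b         ∎)
      where open ≡-Reasoning

    lineSum-parallel : ∀ {d} γ → K d → lineSum (d * b) g γ ≡ ℕtoℚ q ℚ.* g γ
    lineSum-parallel {d} γ Kd =
      trans (∑-cong elements (λ c → when-cong (K? c) (λ Kc → g-cong (back Kc) (away Kc)))) (∑-when-K-const (g γ))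
      where
      away : ∀ {c} → K c → S γ → S (γ - (c * (d * b)))
      away {c} Kc Sγ = subst S (cong (γ +_) (trans (sym (-‿distribˡ-* (c * d) b)) (cong -_ (*-assoc c d b))))
                               (S-translate (K-‿ (K-* Kc Kd)) Sγ)
      back : ∀ {c} → K c → S (γ - (c * (d * b))) → S γ
      back {c} Kc S[γ-cdb] = subst S (trans (cong ((γ - (c * (d * b))) +_) (*-assoc c d b))
                                            (//-rightDividesˡ (c * (d * b)) γ))
                                     (S-translate (K-* Kc Kd) S[γ-cdb])

    lineSum-transversal : ∀ {s} γ → ¬ (∃ λ d → K d × s ≡ d * b) → lineSum s g γ ≡ 0ℚ
    lineSum-transversal {s} γ s∉Kb = begin
      ∑[ c ∈ elements ] when (K? c) (g (γ - (c * s)))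
        ≡⟨ ∑-cong elements (λ c →
           trans (cong (when (K? c)) (gLine≡q*indicator-1 a b (γ - (c * s))))
                 (when-∙ (K? c) (ℕtoℚ q ℚ.* I c) (ℚ.- 1ℚ))) ⟩
      ∑[ c ∈ elements ] (when (K? c) (ℕtoℚ q ℚ.* I c) ℚ.+ when (K? c) (ℚ.- 1ℚ))
        ≡⟨ ∑-∙ elements (λ c → when (K? c) (ℕtoℚ q ℚ.* I c)) (λ c → when (K? c) (ℚ.- 1ℚ)) ⟩
      ∑[ c ∈ elements ] when (K? c) (ℕtoℚ q ℚ.* I c) ℚ.+ ∑[ c ∈ elements ] when (K? c) (ℚ.- 1ℚ)
        ≡⟨ cong₂ ℚ._+_ q*meets-once (∑-when-K-const (ℚ.- 1ℚ)) ⟩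
      ℕtoℚ q ℚ.* 1ℚ ℚ.+ ℕtoℚ q ℚ.* ℚ.- 1ℚ
        ≡⟨ sym (ℚₚ.*-distribˡ-+ (ℕtoℚ q) 1ℚ (ℚ.- 1ℚ)) ⟩
      ℕtoℚ q ℚ.* (1ℚ ℚ.+ ℚ.- 1ℚ)
        ≡⟨ cong (ℕtoℚ q ℚ.*_) (ℚₚ.+-inverseʳ 1ℚ) ⟩
      ℕtoℚ q ℚ.* 0ℚ
        ≡⟨ ℚₚ.*-zeroʳ (ℕtoℚ q) ⟩
      0ℚ ∎
      where
      open ≡-Reasoning
      open Basis b≢0 s∉Kb
      I : Carrier → ℚ
      I c = indicator a b (γ - (c * s))
      meets-once : ∑[ c ∈ elements ] when (K? c) (I c) ≡ 1ℚ
      meets-once = meets-once-at (coordinates (γ - a))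
        where
        meets-once-at : (∃ λ c → ∃ λ e → K c × K e × γ - a ≡ c * s + e * b) →
                        ∑[ c ∈ elements ] when (K? c) (I c) ≡ 1ℚ
        meets-once-at (c₀ , e₀ , Kc₀ , Ke₀ , γ-a≡c₀s+e₀b) = trans
          (∑-cong elements (λ c → when-×-dec (K? c) (onLine? F q a b (γ - (c * s))) 1ℚ))
          (∑-when-unique (λ c → K? c ×-dec onLine? F q a b (γ - (c * s))) (λ _ → 1ℚ) unique (complete c₀)
            (Kc₀ , e₀ , Ke₀ , x-y≡z+w⇒x-z≡y+w γ-a≡c₀s+e₀b)
            (λ { c (Kc , e , Ke , γ-cs≡a+eb) → proj₁ (coordinates-unique Kc Ke Kc₀ Ke₀
                                                        (trans (sym (x-y≡z+w⇒x-z≡y+w γ-cs≡a+eb)) γ-a≡c₀s+e₀b)) }))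
      q*meets-once : ∑[ c ∈ elements ] when (K? c) (ℕtoℚ q ℚ.* I c) ≡ ℕtoℚ q ℚ.* 1ℚ
      q*meets-once = begin
        ∑[ c ∈ elements ] when (K? c) (ℕtoℚ q ℚ.* I c)
          ≡⟨ ∑-cong elements (λ c → when-distribˡ (K? c) (ℕtoℚ q) (I c)) ⟩
        ∑[ c ∈ elements ] (ℕtoℚ q ℚ.* when (K? c) (I c))
          ≡⟨ sym (∑-distribˡ elements (ℕtoℚ q) (λ c → when (K? c) (I c))) ⟩
        ℕtoℚ q ℚ.* ∑[ c ∈ elements ] when (K? c) (I c)
          ≡⟨ cong (ℕtoℚ q ℚ.*_) meets-once ⟩
        ℕtoℚ q ℚ.* 1ℚ ∎

    parallel? : ∀ s d → Dec ((K d × d ≢ 0#) × s ≡ d * b)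
    parallel? s d = K*? d ×-dec (s ≟ (d * b))

    lineSum≡∑parallel : ∀ {s} γ → Square s →
                        lineSum s g γ ≡ ∑[ d ∈ elements ] when (parallel? s d) (ℕtoℚ q ℚ.* g γ)
    lineSum≡∑parallel {s} γ □s with ∃? (parallel? s)
    ... | yes (d , (Kd , d≢0) , refl) =
      trans (lineSum-parallel γ Kd)
            (sym (∑-when-unique (parallel? s) (λ _ → ℕtoℚ q ℚ.* g γ) unique (complete d) ((Kd , d≢0) , refl)
                                (λ d′ (_ , db≡d′b) → *-cancelʳ b b≢0 (sym db≡d′b))))
    ... | no  ∄d =
      trans (lineSum-transversal γ s∉Kb)
            (sym (∑-when-none (parallel? s) (λ _ → ℕtoℚ q ℚ.* g γ) elements (λ {d} _ p → ∄d (d , p))))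
      where
      s∉Kb : ¬ (∃ λ d → K d × s ≡ d * b)
      s∉Kb (d , Kd , s≡db) with d ≟ 0#
      ... | yes refl = Square⇒≢0 □s (trans s≡db (zeroˡ b))
      ... | no  d≢0  = ∄d (d , (Kd , d≢0) , s≡db)

    ∑-lineSums-g : ∀ γ → ∑[ s ∈ elements ] when (square? s) (lineSum s g γ) ≡ ℕtoℚ (2 ℕ.* t) ℚ.* (ℕtoℚ q ℚ.* g γ)
    ∑-lineSums-g γ = begin
      ∑[ s ∈ elements ] when (square? s) (lineSum s g γ)
        ≡⟨ ∑-cong elements (λ s → when-cong (square? s) (lineSum≡∑parallel γ)) ⟩
      ∑[ s ∈ elements ] when (square? s) (∑[ d ∈ elements ] when (parallel? s d) v)
        ≡⟨ ∑-cong elements (λ s → trans (when-∑ (square? s) elements _)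
             (∑-cong elements (λ d → trans (when-×-dec (square? s) (parallel? s d) v)
               (when-⇔ (square? s ×-dec parallel? s d) (parallel? s d) proj₂ (λ p → parallel⇒□ p , p) v)))) ⟩
      ∑[ s ∈ elements ] ∑[ d ∈ elements ] when (parallel? s d) v
        ≡⟨ ∑-swap elements elements _ ⟩
      ∑[ d ∈ elements ] ∑[ s ∈ elements ] when (parallel? s d) v
        ≡⟨ ∑-cong elements (λ d → trans
             (∑-cong elements (λ s → sym (when-×-dec (K*? d) (s ≟ (d * b)) v)))
             (sym (when-∑ (K*? d) elements _))) ⟩
      ∑[ d ∈ elements ] when (K*? d) (∑[ s ∈ elements ] when (s ≟ (d * b)) v)
        ≡⟨ ∑-cong elements (λ d → cong (when (K*? d)) (∑-when-≡ (λ _ → v) (d * b))) ⟩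
      ∑[ d ∈ elements ] when (K*? d) v
        ≡⟨ ∑-when-K*-const v ⟩
      ℕtoℚ (2 ℕ.* t) ℚ.* v ∎
      where
      open ≡-Reasoning
      v = ℕtoℚ q ℚ.* g γ
      parallel⇒□ : ∀ {s d} → (K d × d ≢ 0#) × s ≡ d * b → Square s
      parallel⇒□ ((Kd , d≢0) , refl) = Square-* (K*⇒Square Kd d≢0) □b

    adj-g : ∀ γ → adj g γ ≡ ℕtoℚ t ℚ.* g γ
    adj-g γ = eigenvalue-from-∑-lineSums (trans (sym (∑-lineSums g γ)) (∑-lineSums-g γ))

  θ : ℚ
  θ = (ℕtoℚ q ℚ.- 1ℚ) ℚ.* ½

  θ≡t : θ ≡ ℕtoℚ t
  θ≡t = begin
    (ℕtoℚ q ℚ.- 1ℚ) ℚ.* ½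
      ≡⟨ cong (λ z → (z ℚ.- 1ℚ) ℚ.* ½) (trans (cong ℕtoℚ q≡1+2t) (ℕtoℚ-suc (2 ℕ.* t))) ⟩
    ((1ℚ ℚ.+ ℕtoℚ (2 ℕ.* t)) ℚ.- 1ℚ) ℚ.* ½
      ≡⟨ cong (λ z → (z ℚ.- 1ℚ) ℚ.* ½) (ℚₚ.+-comm 1ℚ (ℕtoℚ (2 ℕ.* t))) ⟩
    ((ℕtoℚ (2 ℕ.* t) ℚ.+ 1ℚ) ℚ.- 1ℚ) ℚ.* ½
      ≡⟨ cong (ℚ._* ½) (Rational.//-rightDividesʳ 1ℚ (ℕtoℚ (2 ℕ.* t))) ⟩
    ℕtoℚ (2 ℕ.* t) ℚ.* ½
      ≡⟨ cong (ℚ._* ½) (trans (ℕtoℚ-* 2 t) (ℚₚ.*-comm (ℕtoℚ 2) (ℕtoℚ t))) ⟩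
    ℕtoℚ t ℚ.* ℕtoℚ 2 ℚ.* ½
      ≡⟨ ℚₚ.*-assoc (ℕtoℚ t) (ℕtoℚ 2) ½ ⟩
    ℕtoℚ t ℚ.* 1ℚ
      ≡⟨ ℚₚ.*-identityʳ (ℕtoℚ t) ⟩
    ℕtoℚ t ∎
    where open ≡-Reasoning

  adj-cong : ∀ {f f′} γ → (∀ δ → f δ ≡ f′ δ) → adj f γ ≡ adj f′ γ
  adj-cong γ f≗f′ = ∑-cong elements (λ s → cong (when (square? s)) (f≗f′ (γ - s)))

  adj-∑ : ∀ {X : Set} (xs : List X) (u : X → Carrier → ℚ) γ →
          adj (λ δ → ∑[ x ∈ xs ] u x δ) γ ≡ ∑[ x ∈ xs ] adj (u x) γ
  adj-∑ xs u γ = trans (∑-cong elements (λ s → when-∑ (square? s) xs (λ x → u x (γ - s))))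
                       (∑-swap elements xs (λ s x → when (square? s) (u x (γ - s))))

  adj-scale : ∀ r f γ → adj (λ δ → r ℚ.* f δ) γ ≡ r ℚ.* adj f γ
  adj-scale r f γ = trans (∑-cong elements (λ s → when-distribˡ (square? s) r (f (γ - s))))
                          (sym (∑-distribˡ elements r (λ s → when (square? s) (f (γ - s)))))

  scaledLine : Carrier → Carrier × Carrier × ℚ → ℚ
  scaledLine γ (a , b , r) = r ℚ.* gLine F q a b γ

  span⇒eigen : ∀ f → InSpanOfQuadraticLines F q f → IsEigenfunction F θ f
  span⇒eigen f (ls , □ls , f≡) γ = begin
    θ ℚ.* f γ
      ≡⟨ cong₂ ℚ._*_ θ≡t (f≡∑ γ) ⟩
    ℕtoℚ t ℚ.* ∑ ls (scaledLine γ)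
      ≡⟨ ∑-distribˡ ls (ℕtoℚ t) _ ⟩
    ∑[ x ∈ ls ] (ℕtoℚ t ℚ.* scaledLine γ x)
      ≡⟨ ∑-cong-∈ ls (λ {x} x∈ls → sym (adj-scaledLine x (All.lookup □ls x∈ls))) ⟩
    ∑[ x ∈ ls ] adj (λ δ → scaledLine δ x) γ
      ≡⟨ sym (adj-∑ ls (λ x δ → scaledLine δ x) γ) ⟩
    adj (λ δ → ∑ ls (scaledLine δ)) γ
      ≡⟨ adj-cong γ (λ δ → sym (f≡∑ δ)) ⟩
    adj f γ
      ≡⟨ sym (sum-neighbours≡adj f γ) ⟩
    sumℚ (map f (filter (paleyAdj? F γ) elements)) ∎
    where
    open ≡-Reasoning
    f≡∑ : ∀ δ → f δ ≡ ∑ ls (scaledLine δ)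
    f≡∑ δ = trans (f≡ δ) (sumℚ≡∑ (scaledLine δ) ls)
    adj-scaledLine : ∀ x → Square (proj₁ (proj₂ x)) → adj (λ δ → scaledLine δ x) γ ≡ ℕtoℚ t ℚ.* scaledLine γ x
    adj-scaledLine (a , b , r) □b = begin
      adj (λ δ → r ℚ.* gLine F q a b δ) γ
        ≡⟨ adj-scale r (gLine F q a b) γ ⟩
      r ℚ.* adj (gLine F q a b) γ
        ≡⟨ cong (r ℚ.*_) (QuadraticLine.adj-g □b γ) ⟩
      r ℚ.* (ℕtoℚ t ℚ.* gLine F q a b γ)
        ≡⟨ trans (sym (ℚₚ.*-assoc r (ℕtoℚ t) (gLine F q a b γ)))
              (trans (cong (ℚ._* gLine F q a b γ) (ℚₚ.*-comm r (ℕtoℚ t)))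
                     (ℚₚ.*-assoc (ℕtoℚ t) r (gLine F q a b γ))) ⟩
      ℕtoℚ t ℚ.* (r ℚ.* gLine F q a b γ) ∎

  shift-invariant : ∀ f s → ∑[ γ ∈ elements ] f (γ - s) ≡ ∑ elements f
  shift-invariant f s = ∑-bijection (λ γ → γ - s) (_+ s) (//-rightDividesˡ s) (//-rightDividesʳ s) f

  ∑-adj : ∀ f → ∑[ γ ∈ elements ] adj f γ ≡ ℕtoℚ (length squares) ℚ.* ∑ elements f
  ∑-adj f = begin
    ∑[ γ ∈ elements ] ∑[ s ∈ elements ] when (square? s) (f (γ - s))
      ≡⟨ ∑-swap elements elements (λ γ s → when (square? s) (f (γ - s))) ⟩
    ∑[ s ∈ elements ] ∑[ γ ∈ elements ] when (square? s) (f (γ - s))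
      ≡⟨ ∑-cong elements (λ s → sym (when-∑ (square? s) elements (λ γ → f (γ - s)))) ⟩
    ∑[ s ∈ elements ] when (square? s) (∑[ γ ∈ elements ] f (γ - s))
      ≡⟨ ∑-cong elements (λ s → cong (when (square? s)) (shift-invariant f s)) ⟩
    ∑[ s ∈ elements ] when (square? s) (∑ elements f)
      ≡⟨ ∑-when-square-const (∑ elements f) ⟩
    ℕtoℚ (length squares) ℚ.* ∑ elements f ∎
    where open ≡-Reasoning

  module Decomposition (f : Carrier → ℚ) (f-eigen : ∀ γ → adj f γ ≡ ℕtoℚ t ℚ.* f γ) where

    ∑f≡0 : ∑ elements f ≡ 0ℚ
    ∑f≡0 = Rational.*-cancelˡ (ℕtoℚ (t ℕ.* q)) (ℕtoℚ≢0 (t ℕ.* q) {{ℕₚ.m*n≢0 t q}})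
      (trans (Rational.+-cancelˡ (ℕtoℚ t ℚ.* S) (ℕtoℚ (t ℕ.* q) ℚ.* S) 0ℚ (begin
        ℕtoℚ t ℚ.* S ℚ.+ ℕtoℚ (t ℕ.* q) ℚ.* S
          ≡⟨ sym (ℚₚ.*-distribʳ-+ S (ℕtoℚ t) (ℕtoℚ (t ℕ.* q))) ⟩
        (ℕtoℚ t ℚ.+ ℕtoℚ (t ℕ.* q)) ℚ.* S
          ≡⟨ cong (ℚ._* S) (sym (trans (cong ℕtoℚ |squares|≡t+t*q) (ℕtoℚ-+ t (t ℕ.* q)))) ⟩
        ℕtoℚ (length squares) ℚ.* S
          ≡⟨ sym (∑-adj f) ⟩
        ∑[ γ ∈ elements ] adj f γ
          ≡⟨ ∑-cong elements f-eigen ⟩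
        ∑[ γ ∈ elements ] (ℕtoℚ t ℚ.* f γ)
          ≡⟨ sym (∑-distribˡ elements (ℕtoℚ t) f) ⟩
        ℕtoℚ t ℚ.* S
          ≡⟨ sym (ℚₚ.+-identityʳ (ℕtoℚ t ℚ.* S)) ⟩
        ℕtoℚ t ℚ.* S ℚ.+ 0ℚ ∎))
      (sym (ℚₚ.*-zeroʳ (ℕtoℚ (t ℕ.* q)))))
      where
      open ≡-Reasoning
      S = ∑ elements f

    f*gLine : ∀ a s γ → f a ℚ.* gLine F q a s γ ≡ ℕtoℚ q ℚ.* (f a ℚ.* indicator a s γ) ℚ.+ ℚ.- 1ℚ ℚ.* f a
    f*gLine a s γ = begin
      f a ℚ.* gLine F q a s γ
        ≡⟨ cong (f a ℚ.*_) (gLine≡q*indicator-1 a s γ) ⟩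
      f a ℚ.* (ℕtoℚ q ℚ.* indicator a s γ ℚ.+ ℚ.- 1ℚ)
        ≡⟨ ℚₚ.*-distribˡ-+ (f a) (ℕtoℚ q ℚ.* indicator a s γ) (ℚ.- 1ℚ) ⟩
      f a ℚ.* (ℕtoℚ q ℚ.* indicator a s γ) ℚ.+ f a ℚ.* ℚ.- 1ℚ
        ≡⟨ cong₂ ℚ._+_ (trans (sym (ℚₚ.*-assoc (f a) (ℕtoℚ q) (indicator a s γ)))
                 (trans (cong (ℚ._* indicator a s γ) (ℚₚ.*-comm (f a) (ℕtoℚ q)))
                        (ℚₚ.*-assoc (ℕtoℚ q) (f a) (indicator a s γ))))
            (ℚₚ.*-comm (f a) (ℚ.- 1ℚ)) ⟩
      ℕtoℚ q ℚ.* (f a ℚ.* indicator a s γ) ℚ.+ ℚ.- 1ℚ ℚ.* f a ∎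
      where open ≡-Reasoning

    ∑-f*gLine : ∀ {s} γ → Square s → ∑[ a ∈ elements ] (f a ℚ.* gLine F q a s γ) ≡ ℕtoℚ q ℚ.* lineSum s f γ
    ∑-f*gLine {s} γ □s = begin
      ∑[ a ∈ elements ] (f a ℚ.* gLine F q a s γ)
        ≡⟨ ∑-cong elements (λ a → f*gLine a s γ) ⟩
      ∑[ a ∈ elements ] (ℕtoℚ q ℚ.* (f a ℚ.* indicator a s γ) ℚ.+ ℚ.- 1ℚ ℚ.* f a)
        ≡⟨ ∑-∙ elements (λ a → ℕtoℚ q ℚ.* (f a ℚ.* indicator a s γ))
                         (λ a → ℚ.- 1ℚ ℚ.* f a) ⟩
      ∑[ a ∈ elements ] (ℕtoℚ q ℚ.* (f a ℚ.* indicator a s γ)) ℚ.+ ∑[ a ∈ elements ] (ℚ.- 1ℚ ℚ.* f a)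
        ≡⟨ cong₂ ℚ._+_ (sym (∑-distribˡ elements (ℕtoℚ q) (λ a → f a ℚ.* indicator a s γ)))
                       (sym (∑-distribˡ elements (ℚ.- 1ℚ) f)) ⟩
      ℕtoℚ q ℚ.* ∑[ a ∈ elements ] (f a ℚ.* indicator a s γ) ℚ.+ ℚ.- 1ℚ ℚ.* ∑ elements f
        ≡⟨ cong₂ (λ x y → ℕtoℚ q ℚ.* x ℚ.+ ℚ.- 1ℚ ℚ.* y)
             (∑-f*indicator≡lineSum (Square⇒≢0 □s) f γ) ∑f≡0 ⟩
      ℕtoℚ q ℚ.* lineSum s f γ ℚ.+ ℚ.- 1ℚ ℚ.* 0ℚ
        ≡⟨ cong (ℕtoℚ q ℚ.* lineSum s f γ ℚ.+_) (ℚₚ.*-zeroʳ (ℚ.- 1ℚ)) ⟩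
      ℕtoℚ q ℚ.* lineSum s f γ ℚ.+ 0ℚ
        ≡⟨ ℚₚ.+-identityʳ (ℕtoℚ q ℚ.* lineSum s f γ) ⟩
      ℕtoℚ q ℚ.* lineSum s f γ ∎
      where open ≡-Reasoning

    N : ℕ
    N = q ℕ.* (2 ℕ.* t ℕ.* q)

    ∑∑-f*gLine : ∀ γ → ∑[ s ∈ squares ] ∑[ a ∈ elements ] (f a ℚ.* gLine F q a s γ) ≡ ℕtoℚ N ℚ.* f γ
    ∑∑-f*gLine γ = begin
      ∑[ s ∈ squares ] ∑[ a ∈ elements ] (f a ℚ.* gLine F q a s γ)
        ≡⟨ ∑-cong-∈ squares (λ s∈squares → ∑-f*gLine γ (proj₂ (∈-filter⁻ square? {xs = elements} s∈squares))) ⟩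
      ∑[ s ∈ squares ] (ℕtoℚ q ℚ.* lineSum s f γ)
        ≡⟨ sym (∑-distribˡ squares (ℕtoℚ q) (λ s → lineSum s f γ)) ⟩
      ℕtoℚ q ℚ.* ∑[ s ∈ squares ] lineSum s f γ
        ≡⟨ cong (ℕtoℚ q ℚ.*_) (∑-filter square? elements (λ s → lineSum s f γ)) ⟩
      ℕtoℚ q ℚ.* ∑[ s ∈ elements ] when (square? s) (lineSum s f γ)
        ≡⟨ cong (ℕtoℚ q ℚ.*_) (∑-lineSums f γ) ⟩
      ℕtoℚ q ℚ.* (ℕtoℚ M ℚ.* f γ ℚ.+ ℕtoℚ (2 ℕ.* t) ℚ.* adj f γ)
        ≡⟨ cong (λ z → ℕtoℚ q ℚ.* (ℕtoℚ M ℚ.* f γ ℚ.+ ℕtoℚ (2 ℕ.* t) ℚ.* z)) (f-eigen γ) ⟩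
      ℕtoℚ q ℚ.* (ℕtoℚ M ℚ.* f γ ℚ.+ ℕtoℚ (2 ℕ.* t) ℚ.* (ℕtoℚ t ℚ.* f γ))
        ≡⟨ cong (ℕtoℚ q ℚ.*_) (M*x+2t*[t*x]≡2t*[q*x] (f γ)) ⟩
      ℕtoℚ q ℚ.* (ℕtoℚ (2 ℕ.* t) ℚ.* (ℕtoℚ q ℚ.* f γ))
        ≡⟨ cong (ℕtoℚ q ℚ.*_) (sym (ℚₚ.*-assoc (ℕtoℚ (2 ℕ.* t)) (ℕtoℚ q) (f γ))) ⟩
      ℕtoℚ q ℚ.* (ℕtoℚ (2 ℕ.* t) ℚ.* ℕtoℚ q ℚ.* f γ)
        ≡⟨ sym (ℚₚ.*-assoc (ℕtoℚ q) (ℕtoℚ (2 ℕ.* t) ℚ.* ℕtoℚ q) (f γ)) ⟩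
      ℕtoℚ q ℚ.* (ℕtoℚ (2 ℕ.* t) ℚ.* ℕtoℚ q) ℚ.* f γ
        ≡⟨ cong (ℚ._* f γ) (sym (trans (ℕtoℚ-* q (2 ℕ.* t ℕ.* q))
                                       (cong (ℕtoℚ q ℚ.*_) (ℕtoℚ-* (2 ℕ.* t) q)))) ⟩
      ℕtoℚ N ℚ.* f γ ∎
      where
      open ≡-Reasoning
      M = length squares

    instance
      N≢0 : ℚ.NonZero (ℕtoℚ N)
      N≢0 = ℚ.≢-nonZero (ℕtoℚ≢0 N {{ℕₚ.m*n≢0 q (2 ℕ.* t ℕ.* q) {{q≢0}} {{ℕₚ.m*n≢0 (2 ℕ.* t) q {{ℕₚ.m*n≢0 2 t}}}}}})

    κ : ℚ
    κ = ℚ.1/ ℕtoℚ N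

    κ*N≡1 : κ ℚ.* ℕtoℚ N ≡ 1ℚ
    κ*N≡1 = ℚₚ.*-inverseˡ (ℕtoℚ N)

    coefficients : List (Carrier × Carrier × ℚ)
    coefficients = concatMap (λ s → map (λ a → a , s , f a ℚ.* κ) elements) squares

    coefficients-quadratic : All.All (λ x → Square (proj₁ (proj₂ x))) coefficients
    coefficients-quadratic = All-concat⁺ (All-map⁺ (All.tabulate (λ s∈squares →
      All-map⁺ (All.tabulate (λ _ → proj₂ (∈-filter⁻ square? {xs = elements} s∈squares))))))

    ∑-coefficients : ∀ γ → ∑ coefficients (scaledLine γ) ≡ f γ
    ∑-coefficients γ = begin
      ∑ coefficients (scaledLine γ)
        ≡⟨ ∑-concatMap (λ s → map (λ a → a , s , f a ℚ.* κ) elements) squares (scaledLine γ) ⟩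
      ∑[ s ∈ squares ] ∑ (map (λ a → a , s , f a ℚ.* κ) elements) (scaledLine γ)
        ≡⟨ ∑-cong squares (λ s → ∑-map (λ a → a , s , f a ℚ.* κ) elements (scaledLine γ)) ⟩
      ∑[ s ∈ squares ] ∑[ a ∈ elements ] (f a ℚ.* κ ℚ.* gLine F q a s γ)
        ≡⟨ ∑-cong squares (λ s → ∑-cong elements (λ a → reorder (f a) (gLine F q a s γ))) ⟩
      ∑[ s ∈ squares ] ∑[ a ∈ elements ] (κ ℚ.* (f a ℚ.* gLine F q a s γ))
        ≡⟨ ∑-cong squares (λ s → sym (∑-distribˡ elements κ (λ a → f a ℚ.* gLine F q a s γ))) ⟩
      ∑[ s ∈ squares ] (κ ℚ.* ∑[ a ∈ elements ] (f a ℚ.* gLine F q a s γ))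
        ≡⟨ sym (∑-distribˡ squares κ (λ s → ∑[ a ∈ elements ] (f a ℚ.* gLine F q a s γ))) ⟩
      κ ℚ.* ∑[ s ∈ squares ] ∑[ a ∈ elements ] (f a ℚ.* gLine F q a s γ)
        ≡⟨ cong (κ ℚ.*_) (∑∑-f*gLine γ) ⟩
      κ ℚ.* (ℕtoℚ N ℚ.* f γ)
        ≡⟨ sym (ℚₚ.*-assoc κ (ℕtoℚ N) (f γ)) ⟩
      κ ℚ.* ℕtoℚ N ℚ.* f γ
        ≡⟨ cong (ℚ._* f γ) κ*N≡1 ⟩
      1ℚ ℚ.* f γ
        ≡⟨ ℚₚ.*-identityˡ (f γ) ⟩
      f γ ∎
      where
      open ≡-Reasoning
      reorder : ∀ x y → x ℚ.* κ ℚ.* y ≡ κ ℚ.* (x ℚ.* y)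
      reorder x y = trans (cong (ℚ._* y) (ℚₚ.*-comm x κ)) (ℚₚ.*-assoc κ x y)

    span : InSpanOfQuadraticLines F q f
    span = coefficients , coefficients-quadratic ,
           λ γ → sym (trans (sumℚ≡∑ (scaledLine γ) coefficients) (∑-coefficients γ))

  eigenfunction⇒adj≡t* : ∀ {f} → IsEigenfunction F θ f → ∀ γ → adj f γ ≡ ℕtoℚ t ℚ.* f γ
  eigenfunction⇒adj≡t* {f} f-eigen γ =
    trans (sym (sum-neighbours≡adj f γ)) (trans (sym (f-eigen γ)) (cong (ℚ._* f γ) θ≡t))

open import Data.Nat using (ℕ; _*_)
open import Data.Rational using (ℚ; _-_; 1ℚ; ½) renaming (_*_ to _*ℚ_)

proposition1 : (q : ℕ) → IsOddPrimePower q →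
    (F : FiniteField) → FiniteField.order F ≡ q * q →
    (f : FiniteField.Carrier F → ℚ) →
    IsEigenfunction F ((ℕtoℚ q - 1ℚ) *ℚ ½) f ⇔ InSpanOfQuadraticLines F q f
proposition1 q (p , k , p-prime , q≡pᵏ⁺¹ , q-odd) F order≡q² f =
  mk⇔ (Decomposition.span f ∘ eigenfunction⇒adj≡t*) (span⇒eigen f)
  where open PaleyEigenspace F q {p} {k} p-prime q≡pᵏ⁺¹ q-odd order≡q²
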